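{- Let $q$ be a prime power, $n\ge 2$, and $f(X)=\sum_{i=0}^{q^n-1}a_iX^i\in\mathbb F_{q^n}[X]$. Then $f:\mathbb F_{q^n}\to\mathbb F_{q^n}$ is $(n-1)$th order sum-free if and only if both of the following hold: (1) for all $b\in\mathbb F_{q^n}^*$, \[ a_{q^n-1}\ne\sum_{j_0+\cdots+j_{n-1}=q-1}\binom{q-1}{j_0,\dots,j_{n-1}}a_{q^n-1-(j_0q^0+\cdots+j_{n-1}q^{n-1})}\,b^{j_0q^0+\cdots+j_{n-1}q^{n-1}}; \] (2) for all $b\in\mathbb F_{q^n}^*$ and $c\in\mathbb F_q^*$, \[ \sum_{0<j_0+\cdots+j_{n-1}\le q-1}\binom{j_0+\cdots+j_{n-1}}{j_0,\dots,j_{n-1}}a_{q^n-1-(j_0q^0+\cdots+j_{n-1}q^{n-1})}\,b^{j_0q^0+\cdots+j_{n-1}q^{n-1}}\,c^{q-1-(j_0+\cdots+j_{n-1})}\ne 0. \] Here the sums run over tuples $(j_0,\dots,j_{n-1})$ of nonnegative integers, and the multinomial coefficients are interpreted in $\mathbb F_q$.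
   Context: A function $f:\mathbb F_{q^n}\to\mathbb F_{q^n}$ is $k$th order sum-free if $\sum_{x\in A}f(x)\ne0$ for every $k$-dimensional $\mathbb F_q$-affine subspace $A$ of $\mathbb F_{q^n}$. -}

module Defs where

open import Level using (Level; _⊔_; suc)
open import Algebra.Bundles using (CommutativeRing)
import Data.Nat as ℕ
open ℕ using (ℕ; zero; suc; _^_; _∸_)
open import Relation.Binary.PropositionalEquality using (_≡_)
open import Data.Nat.Combinatorics using (_C_)
open import Data.List using (List; []; _∷_; foldr; filter; map; upTo; concatMap; length)
open import Data.List.Relation.Unary.Any using (Any)
open import Data.List.Relation.Unary.AllPairs using (AllPairs)
open import Data.Vec using (Vec; []; _∷_)
open import Data.Vec.Relation.Unary.All as VAll using ()
open import Data.Product using (Σ; ∃; _×_)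
open import Relation.Nullary using (¬_)
open import Relation.Binary using (Decidable)
open import Relation.Nullary.Decidable using (_×-dec_)

-- A finite field: a commutative ring with 0 ≠ 1, inverses of nonzero
-- elements, decidable equality, and an explicit duplicate-free complete
-- enumeration of its elements (its order is the length of the enumeration).
record FiniteField (c ℓ : Level) : Set (Level.suc (c ⊔ ℓ)) where
  field
    commRing : CommutativeRing c ℓ
  open CommutativeRing commRing public
  field
    _≟_      : Decidable _≈_
    0≉1      : ¬ (0# ≈ 1#)
    inverse  : ∀ x → ¬ (x ≈ 0#) → Σ Carrier (λ y → (x * y) ≈ 1#)
    elems    : List Carrier
    complete : ∀ x → Any (x ≈_) elems
    distinct : AllPairs (λ x y → ¬ (x ≈ y)) elems

open import Data.Nat.Primality using (Prime)
IsPrimePower : ℕ → Set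
IsPrimePower q = Σ ℕ (λ p → Σ ℕ (λ m → Prime p × (0 ℕ.< m) × (q ≡ p ^ m)))

allVecs : ∀ {a} {A : Set a} → List A → (k : ℕ) → List (Vec A k)
allVecs xs zero    = [] ∷ []
allVecs xs (suc k) = concatMap (λ x → map (x ∷_) (allVecs xs k)) xs

sumV : ∀ {k} → Vec ℕ k → ℕ
sumV []       = 0
sumV (j ∷ js) = j ℕ.+ sumV js

-- j₀ q⁰ + j₁ q¹ + ⋯ + j_{k-1} q^{k-1}
weight : ℕ → ∀ {k} → Vec ℕ k → ℕ
weight q []       = 0
weight q (j ∷ js) = j ℕ.+ q ℕ.* weight q js

-- multinomial coefficient (j₀+⋯+j_{k-1})! / (j₀! ⋯ j_{k-1}!)
-- computed as the product of binomials  C(j₀+rest, j₀) · multinomial(rest)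
multinomial : ∀ {k} → Vec ℕ k → ℕ
multinomial []       = 1
multinomial (j ∷ js) = ((j ℕ.+ sumV js) C j) ℕ.* multinomial js

module FiniteFieldNotions {c ℓ} (F : FiniteField c ℓ) (q : ℕ) where
  open FiniteField F

  pow : Carrier → ℕ → Carrier
  pow x zero    = 1#
  pow x (suc m) = x * pow x m

  cast : ℕ → Carrier
  cast zero    = 0#
  cast (suc m) = 1# + cast m

  ΣL : ∀ {a} {A : Set a} → List A → (A → Carrier) → Carrier
  ΣL xs g = foldr (λ x acc → g x + acc) 0# xs

  InFq : Carrier → Set ℓ
  InFq x = pow x q ≈ x

  Fq : List Carrier
  Fq = filter (λ x → pow x q ≟ x) elems

  lin : ∀ {k} → Vec Carrier k → Vec Carrier k → Carrier
  lin []       []       = 0#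
  lin (c ∷ cs) (v ∷ vs) = (c * v) + lin cs vs

  IndependentFq : ∀ {k} → Vec Carrier k → Set (c ⊔ ℓ)
  IndependentFq {k} v = (cs : Vec Carrier k) → VAll.All InFq cs →
                        lin cs v ≈ 0# → VAll.All (_≈ 0#) cs

  -- sum of g over the affine subspace  a + span_{F_q}(v)
  -- (each point listed once when v is F_q-independent)
  affineSum : ∀ {k} → (Carrier → Carrier) → Carrier → Vec Carrier k → Carrier
  affineSum {k} g a v = ΣL (allVecs Fq k) (λ cs → g (a + lin cs v))

  SumFree : ℕ → (Carrier → Carrier) → Set (c ⊔ ℓ)
  SumFree k g = (a : Carrier) (v : Vec Carrier k) → IndependentFq v →
                ¬ (affineSum g a v ≈ 0#)

  polyFun : ℕ → (ℕ → Carrier) → Carrier → Carrier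
  polyFun N a x = ΣL (upTo N) (λ i → a i * pow x i)

  tuples : (n : ℕ) → List (Vec ℕ n)
  tuples n = allVecs (upTo q) n

  term : (n : ℕ) → (ℕ → Carrier) → Carrier → Vec ℕ n → Carrier
  term n a b j = (cast (multinomial j) * a ((q ^ n) ∸ 1 ∸ weight q j)) * pow b (weight q j)

  Condition1 : (n : ℕ) → (ℕ → Carrier) → Set (c ⊔ ℓ)
  Condition1 n a = (b : Carrier) → ¬ (b ≈ 0#) →
    ¬ (a ((q ^ n) ∸ 1) ≈ ΣL (filter (λ j → sumV j ℕ.≟ (q ∸ 1)) (tuples n)) (term n a b))

  Condition2 : (n : ℕ) → (ℕ → Carrier) → Set (c ⊔ ℓ)
  Condition2 n a = (b : Carrier) → ¬ (b ≈ 0#) → (c' : Carrier) → InFq c' → ¬ (c' ≈ 0#) →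
    ¬ (ΣL (filter (λ j → (1 ℕ.≤? sumV j) ×-dec (sumV j ℕ.≤? (q ∸ 1))) (tuples n))
          (λ j → term n a b j * pow c' ((q ∸ 1) ∸ sumV j)) ≈ 0#)

{-# OPTIONS --safe #-}

-- Write F = F_{q^n}, d = n - 1 and T b x = Tr (b x) for the trace Tr : F → F_q. The d-dimensional
-- F_q-affine subspaces of F are exactly the fibres {x | T b x = u} with b ≠ 0 and u ∈ F_q: a fibre
-- is a translate of the d-dimensional kernel of T b, and conversely any d vectors are annihilated by
-- some T b by pigeonhole. On F_q the indicator of t = u is 1 - (t - u)^(q-1), and
-- (t - u)^(q-1) = Σ_{m<q} t^m u^(q-1-m). For m < q the power Tr(b x)^m expands multinomially into
-- Σ_{|j| = m} (|j| choose j) (b x)^J with J = Σ j_i q^i, and Σ_x f(x) x^e = -a_{q^n-1-e} for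
-- e < q^n - 1. So the sum of f over the fibre is -a_{q^n-1} + Σ_{|j| ≤ q-1} (|j| choose j) a_{q^n-1-J}
-- b^J u^(q-1-|j|). For u = 0 only |j| = q - 1 survives, which is condition (1); for u ≠ 0 the term
-- j = 0 cancels -a_{q^n-1} because u^(q-1) = 1, which leaves condition (2).

module Submission where

open import Defs
open import Level using (Level; _⊔_)
open import Algebra.Bundles using (CommutativeMonoid)
open import Data.Bool using (if_then_else_; true; false)
open import Data.Empty using (⊥-elim)
open import Data.List using (List; []; _∷_; _++_; map; filter; foldr; length; concatMap; upTo; applyUpTo)
open import Data.List.Relation.Unary.Any as Any using (Any; here; there)
open import Data.List.Relation.Unary.All as All using (All; []; _∷_)
import Data.List.Relation.Unary.All.Properties as Allₚ
open import Data.List.Relation.Unary.AllPairs using (AllPairs; []; _∷_)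
open import Data.Nat as ℕ using (ℕ; zero; suc; _≤_; _<_; _^_; _∸_; z≤n; s≤s)
import Data.Nat.Properties as ℕP
open import Data.Product using (Σ; ∃; ∃₂; _×_; _,_; proj₁; proj₂)
open import Data.Sum using (_⊎_; inj₁; inj₂)
open import Data.Vec as Vec using (Vec; []; _∷_)
import Data.Vec.Relation.Unary.All as VAll
open import Function using (_∘_)
open import Function.Bundles using (_⇔_; mk⇔)
open import Relation.Binary.Bundles using (Setoid; DecSetoid)
open import Relation.Binary.Definitions using (tri<; tri≈; tri>)
open import Relation.Binary.PropositionalEquality as ≡ using (_≡_; _≢_)
open import Relation.Nullary using (¬_; Dec; yes; no; does)
open import Relation.Nullary.Decidable using (_×-dec_; _→-dec_)
import Relation.Unary

module UniqueLists {a ℓ} (S : Setoid a ℓ) where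
  open Setoid S
  open import Data.List.Membership.Setoid S using (_∈_)
  open import Data.List.Relation.Unary.Unique.Setoid S using (Unique)
  open import Data.List.Relation.Binary.Subset.Setoid S using (_⊆_)

  ∈-split : ∀ {x ys} → x ∈ ys → ∃₂ λ ys₁ ys₂ → ∃ λ y → ys ≡ ys₁ ++ y ∷ ys₂ × x ≈ y
  ∈-split {ys = y ∷ ys} (here x≈y) = [] , ys , y , ≡.refl , x≈y
  ∈-split {ys = y ∷ ys} (there x∈ys) with ∈-split x∈ys
  ... | ys₁ , ys₂ , z , ≡.refl , x≈z = y ∷ ys₁ , ys₂ , z , ≡.refl , x≈z

  ∈-insert : ∀ ys₁ {y ys₂ x} → x ∈ ys₁ ++ ys₂ → x ∈ ys₁ ++ y ∷ ys₂
  ∈-insert []        x∈ys         = there x∈ys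
  ∈-insert (_ ∷ ys₁) (here x≈w)   = here x≈w
  ∈-insert (_ ∷ ys₁) (there x∈ys) = there (∈-insert ys₁ x∈ys)

  ∈-remove : ∀ ys₁ {y ys₂ x} → x ∈ ys₁ ++ y ∷ ys₂ → ¬ x ≈ y → x ∈ ys₁ ++ ys₂
  ∈-remove []        (here x≈y)   x≉y = ⊥-elim (x≉y x≈y)
  ∈-remove []        (there x∈ys) _   = x∈ys
  ∈-remove (_ ∷ ys₁) (here x≈w)   _   = here x≈w
  ∈-remove (_ ∷ ys₁) (there x∈ys) x≉y = there (∈-remove ys₁ x∈ys x≉y)

  unique-remove : ∀ ys₁ {y ys₂} → Unique (ys₁ ++ y ∷ ys₂) → Unique (ys₁ ++ ys₂)
  unique-remove []        (_ ∷ u)   = u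
  unique-remove (_ ∷ ys₁) (w≉ ∷ u) = Allₚ.++⁺ (Allₚ.++⁻ˡ ys₁ w≉) (All.tail (Allₚ.++⁻ʳ ys₁ w≉)) ∷ unique-remove ys₁ u

  unique-removed : ∀ ys₁ {y ys₂ x} → Unique (ys₁ ++ y ∷ ys₂) → x ∈ ys₁ ++ ys₂ → ¬ x ≈ y
  unique-removed []        (y≉ ∷ _) x∈ys₂ x≈y =
    All.lookupWith (λ y≉w x≈w → y≉w (trans (sym x≈y) x≈w)) y≉ x∈ys₂
  unique-removed (w ∷ ys₁) (w≉ ∷ _) (here x≈w) x≈y =
    All.head (Allₚ.++⁻ʳ ys₁ w≉) (trans (sym x≈w) x≈y)
  unique-removed (w ∷ ys₁) (_ ∷ u) (there x∈ys) = unique-removed ys₁ u x∈ys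

  length-mono-⊆ : ∀ {xs ys} → Unique xs → xs ⊆ ys → length xs ≤ length ys
  length-mono-⊆ {[]}     _        _  = z≤n
  length-mono-⊆ {x ∷ xs} (x≉ ∷ u) xs⊆ys with ∈-split (xs⊆ys (here refl))
  ... | ys₁ , ys₂ , y , ≡.refl , x≈y = ℕP.≤-trans
    (s≤s (length-mono-⊆ u λ z∈xs → ∈-remove ys₁ (xs⊆ys (there z∈xs)) (λ z≈y → lookup≉ z∈xs (trans z≈y (sym x≈y)))))
    (ℕP.≤-reflexive (≡.sym (length-++-sucʳ ys₁ y ys₂)))
    where
    open import Data.List.Properties using (length-++-sucʳ)
    lookup≉ : ∀ {z} → z ∈ xs → ¬ z ≈ x
    lookup≉ = All.lookupWith (λ x≉w z≈w z≈x → x≉w (trans (sym z≈x) z≈w)) x≉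

module _ {a ℓ} (S : DecSetoid a ℓ) where
  open DecSetoid S
  open import Data.List.Membership.Setoid setoid using (_∈_)
  open import Data.List.Relation.Unary.Unique.Setoid setoid using (Unique)
  open import Relation.Nullary using (¬?)
  open import Data.List.Properties using (filter-all)

  length-filter-≉ : ∀ {z xs} → Unique xs → z ∈ xs → suc (length (filter (λ x → ¬? (x ≟ z)) xs)) ≡ length xs
  length-filter-≉ {z} {x ∷ xs} (x≉ ∷ u) z∈ with x ≟ z | z∈
  ... | yes x≈z | _          = ≡.cong (suc ∘ length) (filter-all (λ y → ¬? (y ≟ z))
                                  (All.map (λ x≉y y≈z → x≉y (trans x≈z (sym y≈z))) x≉))
  ... | no  x≉z | here z≈x   = ⊥-elim (x≉z (sym z≈x))
  ... | no  x≉z | there z∈xs = ≡.cong suc (length-filter-≉ u z∈xs)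

AllPairs-map-All : ∀ {a p r s} {A : Set a} {P : A → Set p} {R : A → A → Set r} {S : A → A → Set s} {xs} →
                   (∀ {x y} → P x → P y → R x y → S x y) → All P xs → AllPairs R xs → AllPairs S xs
AllPairs-map-All f []         []         = []
AllPairs-map-All f (px ∷ pxs) (rxs ∷ rs) = All.zipWith (λ (py , rxy) → f px py rxy) (pxs , rxs) ∷ AllPairs-map-All f pxs rs

module _ where
  open import Data.Nat.Combinatorics using (_C_; nC1≡n; nCk+nC[k+1]≡[n+1]C[k+1])
  open import Data.Nat.Primality using (Prime; euclidsLemma)
  open import Data.Nat.Divisibility using (_∣_; divides; ∣⇒≤)
  open import Data.Nat.Tactic.RingSolver using (solve-∀)
  open import Data.Nat using (_+_; _*_)

  C-absorption : ∀ n k → suc k * (suc n C suc k) ≡ suc n * (n C k)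
  C-absorption zero    zero    = ≡.refl
  C-absorption zero    (suc k) = ℕP.*-zeroʳ (suc (suc k))
  C-absorption (suc n) zero    = ≡.trans (ℕP.*-identityˡ _) (≡.trans (nC1≡n (suc (suc n))) (≡.sym (ℕP.*-identityʳ _)))
  C-absorption (suc n) (suc k) = begin
    suc (suc k) * (suc (suc n) C suc (suc k))              ≡⟨ ≡.cong (suc (suc k) *_) (nCk+nC[k+1]≡[n+1]C[k+1] (suc n) (suc k)) ⟨
    suc (suc k) * (A + B)                                  ≡⟨ split k A B ⟩
    A + (suc k * A + suc (suc k) * B)                      ≡⟨ ≡.cong₂ (λ u v → A + (u + v)) (C-absorption n k) (C-absorption n (suc k)) ⟩
    A + (suc n * (n C k) + suc n * (n C suc k))            ≡⟨ factor n A (n C k) (n C suc k) ⟩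
    A + suc n * (n C k + n C suc k)                        ≡⟨ ≡.cong (λ u → A + suc n * u) (nCk+nC[k+1]≡[n+1]C[k+1] n k) ⟩
    A + suc n * A                                          ≡⟨⟩
    suc (suc n) * A                                        ∎
    where
    open ≡.≡-Reasoning
    A = suc n C suc k
    B = suc n C suc (suc k)
    split : ∀ k A B → suc (suc k) * (A + B) ≡ A + (suc k * A + suc (suc k) * B)
    split = solve-∀
    factor : ∀ n A X Y → A + (suc n * X + suc n * Y) ≡ A + suc n * (X + Y)
    factor = solve-∀

  prime∣C : ∀ {p k} → Prime p → 0 < k → k < p → p ∣ p C k
  prime∣C {suc n} {suc k} p-prime _ k<p
    with euclidsLemma (suc k) (suc n C suc k) p-prime (divides (n C k) (≡.trans (C-absorption n k) (ℕP.*-comm (suc n) (n C k))))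
  ... | inj₁ p∣k = ⊥-elim (ℕP.<⇒≱ k<p (∣⇒≤ p∣k))
  ... | inj₂ p∣C = p∣C

  weight≤sum*q^ : ∀ q → 1 ≤ q → ∀ {k} (j : Vec ℕ (suc k)) → weight q j ≤ sumV j * q ^ k
  weight≤sum*q^ q 1≤q (x ∷ []) =
    ℕP.≤-reflexive (≡.trans (≡.cong (x +_) (ℕP.*-zeroʳ q)) (≡.sym (ℕP.*-identityʳ _)))
  weight≤sum*q^ q 1≤q {suc k} (x ∷ y ∷ js) = begin
    x + q * weight q (y ∷ js)            ≤⟨ ℕP.+-monoʳ-≤ x (ℕP.*-monoʳ-≤ q (weight≤sum*q^ q 1≤q (y ∷ js))) ⟩
    x + q * (S * q ^ k)              ≡⟨ ≡.cong (x +_) (ℕP.*-comm q (S * q ^ k)) ⟩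
    x + (S * q ^ k) * q              ≡⟨ ≡.cong (x +_) (ℕP.*-assoc S (q ^ k) q) ⟩
    x + S * (q ^ k * q)              ≡⟨ ≡.cong (λ t → x + S * t) (ℕP.*-comm (q ^ k) q) ⟩
    x + S * q ^ suc k                  ≤⟨ ℕP.+-monoˡ-≤ _ (ℕP.m≤m*n x (q ^ suc k)) ⟩
    x * q ^ suc k + S * q ^ suc k  ≡⟨ ℕP.*-distribʳ-+ (q ^ suc k) x S ⟨
    (x + S) * q ^ suc k                ∎
    where
    open ℕP.≤-Reasoning
    S = sumV (y ∷ js)
    instance
      _ = ℕ.>-nonZero 1≤q
      _ = ℕ.>-nonZero (ℕP.m^n>0 q (suc k))

  weight<q^∸1 : ∀ {q d} → 1 < q → 1 ≤ d → (j : Vec ℕ (suc d)) → sumV j ≤ q ∸ 1 →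
                weight q j < q ^ suc d ∸ 1
  weight<q^∸1 {q} {d} 1<q 1≤d j |j|≤q-1 = ℕP.≤-pred (begin
    suc (suc (weight q j))                   ≤⟨ s≤s (s≤s (weight≤sum*q^ q 1≤q j)) ⟩
    suc (suc (sumV j * q ^ d))           ≤⟨ s≤s (s≤s (ℕP.*-monoˡ-≤ (q ^ d) |j|≤q-1)) ⟩
    2 + (q ∸ 1) * q ^ d                ≤⟨ ℕP.+-monoˡ-≤ _ 2≤qᵈ ⟩
    q ^ d + (q ∸ 1) * q ^ d          ≡⟨ ≡.cong (_* q ^ d) (ℕP.suc-pred q) ⟩
    q ^ suc d                              ≡⟨ ℕP.suc-pred (q ^ suc d) {{ℕ.>-nonZero (ℕP.m^n>0 q (suc d))}} ⟨
    suc (q ^ suc d ∸ 1)                    ∎)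
    where
    open ℕP.≤-Reasoning
    1≤q = ℕP.<⇒≤ 1<q
    instance _ = ℕ.>-nonZero 1≤q
    2≤qᵈ : 2 ≤ q ^ d
    2≤qᵈ = ℕP.≤-trans 1<q (ℕP.≤-trans (ℕP.≤-reflexive (≡.sym (ℕP.*-identityʳ q))) (ℕP.^-monoʳ-≤ q 1≤d))

  n<2^n : ∀ n → n < 2 ^ n
  n<2^n zero    = s≤s z≤n
  n<2^n (suc n) = ℕP.<-≤-trans (ℕP.+-mono-≤-< (ℕP.m^n>0 2 n) (n<2^n n))
                               (ℕP.≤-reflexive (≡.cong (2 ^ n +_) (≡.sym (ℕP.+-identityʳ _))))

module _ {a} {A : Set a} where
  open import Data.List.Properties using (length-++; length-map)

  length-allVecs : ∀ (xs : List A) k → length (allVecs xs k) ≡ length xs ^ k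
  length-allVecs xs zero    = ≡.refl
  length-allVecs xs (suc k) = ≡.trans (length-concatMap xs) (≡.cong (length xs ℕ.*_) (length-allVecs xs k))
    where
    length-concatMap : ∀ ys → length (concatMap (λ y → map (y ∷_) (allVecs xs k)) ys) ≡ length ys ℕ.* length (allVecs xs k)
    length-concatMap []       = ≡.refl
    length-concatMap (y ∷ ys) = ≡.trans (length-++ (map (y ∷_) (allVecs xs k)))
                                  (≡.cong₂ ℕ._+_ (length-map (y ∷_) (allVecs xs k)) (length-concatMap ys))

  allVecs-All : ∀ {p} {P : A → Set p} {xs} k → All P xs → All (VAll.All P) (allVecs xs k)
  allVecs-All zero    _   = VAll.[] ∷ []
  allVecs-All {xs = xs} (suc k) Pxs = Allₚ.concat⁺ (Allₚ.map⁺ (All.map (λ Px → Allₚ.map⁺ (All.map (Px VAll.∷_) (allVecs-All k Pxs))) Pxs))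

module _ {a ℓ} (S : Setoid a ℓ) where
  open Setoid S
  open import Data.Vec.Relation.Binary.Equality.Setoid S using (≋-setoid)
  open import Data.Vec.Relation.Binary.Pointwise.Inductive using ([]; _∷_; head; tail)
  open import Data.List.Membership.Setoid S using (_∈_)
  open import Data.List.Relation.Unary.Unique.Setoid S using (Unique)
  import Data.List.Membership.Setoid
  import Data.List.Relation.Unary.Unique.Setoid
  open import Data.List.Membership.Setoid.Properties using (∈-map⁻; ∈-concat⁺)
  import Data.List.Relation.Unary.Unique.Setoid.Properties as Uniqueₚ
  import Data.List.Relation.Unary.Any.Properties as Anyₚ
  import Data.List.Relation.Unary.AllPairs as AllPairs
  import Data.List.Relation.Unary.AllPairs.Properties as AllPairsₚ
  private
    _∈ᵛ_ : ∀ {k} → Vec Carrier k → List (Vec Carrier k) → Set (a ⊔ ℓ)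
    _∈ᵛ_ {k} = Data.List.Membership.Setoid._∈_ (≋-setoid k)
    Uniqueᵛ : ∀ {k} → List (Vec Carrier k) → Set (a ⊔ ℓ)
    Uniqueᵛ {k} = Data.List.Relation.Unary.Unique.Setoid.Unique (≋-setoid k)

  ∈-allVecs : ∀ {xs k} {cs : Vec Carrier k} → VAll.All (_∈ xs) cs → cs ∈ᵛ allVecs xs k
  ∈-allVecs VAll.[]              = here []
  ∈-allVecs {xs} (c∈ VAll.∷ cs∈) =
    ∈-concat⁺ (≋-setoid _) (Anyₚ.map⁺ (Any.map (λ c≈y → Anyₚ.map⁺ (Any.map (c≈y ∷_) (∈-allVecs cs∈))) c∈))

  allVecs-unique : ∀ {xs} k → Unique xs → Uniqueᵛ (allVecs xs k)
  allVecs-unique zero    _ = [] ∷ []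
  allVecs-unique {xs} (suc k) u = Uniqueₚ.concat⁺ (≋-setoid (suc k))
    (Allₚ.map⁺ (All.universal (λ _ → Uniqueₚ.map⁺ (≋-setoid k) (≋-setoid (suc k)) tail (allVecs-unique k u)) xs))
    (AllPairsₚ.map⁺ (AllPairs.map disjoint u))
    where
    disjoint : ∀ {x y} → ¬ x ≈ y → ∀ {v} → ¬ (v ∈ᵛ map (x ∷_) (allVecs xs k) × v ∈ᵛ map (y ∷_) (allVecs xs k))
    disjoint x≉y {_ ∷ _} (v∈x , v∈y) with ∈-map⁻ (≋-setoid k) (≋-setoid (suc k)) v∈x | ∈-map⁻ (≋-setoid k) (≋-setoid (suc k)) v∈y
    ... | _ , _ , v≋x∷ | _ , _ , v≋y∷ = x≉y (trans (sym (head v≋x∷)) (head v≋y∷))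

module BigOperators {c ℓ} (M : CommutativeMonoid c ℓ) where
  open CommutativeMonoid M renaming (Carrier to R)
  open import Relation.Binary.Reasoning.Setoid setoid
  open import Algebra.Properties.CommutativeSemigroup commutativeSemigroup using (interchange; x∙yz≈y∙xz)

  private variable
    a b : Level
    A : Set a
    B : Set b

  fold : List A → (A → R) → R
  fold xs g = foldr (λ x acc → g x ∙ acc) ε xs


  fold-cong : (xs : List A) {g h : A → R} → (∀ x → g x ≈ h x) → fold xs g ≈ fold xs h
  fold-cong []       g≈h = refl
  fold-cong (x ∷ xs) g≈h = ∙-cong (g≈h x) (fold-cong xs g≈h)

  fold-cong-All : {xs : List A} {g h : A → R} → All (λ x → g x ≈ h x) xs → fold xs g ≈ fold xs h
  fold-cong-All []           = refl
  fold-cong-All (gx≈hx ∷ es) = ∙-cong gx≈hx (fold-cong-All es)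

  fold-++ : (xs ys : List A) (g : A → R) → fold (xs ++ ys) g ≈ fold xs g ∙ fold ys g
  fold-++ []       ys g = sym (identityˡ _)
  fold-++ (x ∷ xs) ys g = trans (∙-congˡ (fold-++ xs ys g)) (sym (assoc _ _ _))

  fold-ε : (xs : List A) → fold xs (λ _ → ε) ≈ ε
  fold-ε []       = refl
  fold-ε (x ∷ xs) = trans (∙-congˡ (fold-ε xs)) (identityˡ ε)

  fold-∙ : (xs : List A) (g h : A → R) → fold xs (λ x → g x ∙ h x) ≈ fold xs g ∙ fold xs h
  fold-∙ []       g h = sym (identityˡ ε)
  fold-∙ (x ∷ xs) g h = trans (∙-congˡ (fold-∙ xs g h)) (interchange _ _ _ _)

  fold-map : (f : B → A) (xs : List B) (g : A → R) → fold (map f xs) g ≡ fold xs (g ∘ f)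
  fold-map f []       g = ≡.refl
  fold-map f (x ∷ xs) g = ≡.cong (g (f x) ∙_) (fold-map f xs g)

  fold-concatMap : (f : B → List A) (xs : List B) (g : A → R) →
                   fold (concatMap f xs) g ≈ fold xs (λ x → fold (f x) g)
  fold-concatMap f []       g = refl
  fold-concatMap f (x ∷ xs) g = trans (fold-++ (f x) (concatMap f xs) g) (∙-congˡ (fold-concatMap f xs g))

  fold-comm : (xs : List A) (ys : List B) (g : A → B → R) →
              fold xs (λ x → fold ys (g x)) ≈ fold ys (λ y → fold xs (λ x → g x y))
  fold-comm []       ys g = sym (fold-ε ys)
  fold-comm (x ∷ xs) ys g = begin
    fold ys (g x) ∙ fold xs (λ x′ → fold ys (g x′))          ≈⟨ ∙-congˡ (fold-comm xs ys g) ⟩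
    fold ys (g x) ∙ fold ys (λ y → fold xs (λ x′ → g x′ y))  ≈⟨ fold-∙ ys (g x) _ ⟨
    fold ys (λ y → g x y ∙ fold xs (λ x′ → g x′ y))          ∎

  module _ {s ℓs} (S : Setoid s ℓs) where
    open Setoid S using () renaming (Carrier to E; _≈_ to _≈ₛ_; refl to reflₛ; sym to symₛ; trans to transₛ)
    open import Data.List.Membership.Setoid S using (_∈_)
    open import Data.List.Relation.Unary.Unique.Setoid S using (Unique)
    open import Data.List.Relation.Binary.Subset.Setoid S using (_⊆_)
    open UniqueLists S

    fold-insert : ∀ ys₁ y ys₂ (g : E → R) → fold (ys₁ ++ y ∷ ys₂) g ≈ g y ∙ fold (ys₁ ++ ys₂) g
    fold-insert []        y ys₂ g = refl
    fold-insert (w ∷ ys₁) y ys₂ g = trans (∙-congˡ (fold-insert ys₁ y ys₂ g)) (x∙yz≈y∙xz _ _ _)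

    fold-reindex : ∀ {xs ys} (g : E → R) → (∀ {x y} → x ≈ₛ y → g x ≈ g y) →
                   Unique xs → Unique ys → xs ⊆ ys → ys ⊆ xs → fold xs g ≈ fold ys g
    fold-reindex {[]}     {[]}    g g-cong _ _ _ _ = refl
    fold-reindex {[]}     {y ∷ _} g g-cong _ _ _ ys⊆[] with ys⊆[] (here reflₛ)
    ... | ()
    fold-reindex {x ∷ xs} {ys} g g-cong (x≉ ∷ u) v xs⊆ys ys⊆xs with ∈-split (xs⊆ys (here reflₛ))
    ... | ys₁ , ys₂ , y , ≡.refl , x≈y = begin
      g x ∙ fold xs g              ≈⟨ ∙-cong (g-cong x≈y) (fold-reindex g g-cong u (unique-remove ys₁ v) ⊆-removed removed-⊆) ⟩
      g y ∙ fold (ys₁ ++ ys₂) g    ≈⟨ fold-insert ys₁ y ys₂ g ⟨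
      fold (ys₁ ++ y ∷ ys₂) g      ∎
      where
      ⊆-removed : xs ⊆ ys₁ ++ ys₂
      ⊆-removed z∈xs = ∈-remove ys₁ (xs⊆ys (there z∈xs))
        λ z≈y → All.lookupWith (λ x≉w z≈w → x≉w (transₛ (transₛ x≈y (symₛ z≈y)) z≈w)) x≉ z∈xs
      removed-⊆ : ys₁ ++ ys₂ ⊆ xs
      removed-⊆ z∈ys with ys⊆xs (∈-insert ys₁ z∈ys)
      ... | here z≈x    = ⊥-elim (unique-removed ys₁ v z∈ys (transₛ z≈x x≈y))
      ... | there z∈xs = z∈xs

    fold-∘-bijection : ∀ {xs} (f : E → E) (g : E → R) → (∀ {x y} → x ≈ₛ y → g x ≈ g y) →
                       (∀ {x y} → x ≈ₛ y → f x ≈ₛ f y) → (∀ {x y} → f x ≈ₛ f y → x ≈ₛ y) → Unique xs →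
                       (∀ {x} → x ∈ xs → f x ∈ xs) → (∀ {y} → y ∈ xs → ∃ λ x → x ∈ xs × y ≈ₛ f x) →
                       fold xs (g ∘ f) ≈ fold xs g
    fold-∘-bijection {xs} f g g-cong f-cong f-inj u into onto = begin
      fold xs (g ∘ f)     ≡⟨ fold-map f xs g ⟨
      fold (map f xs) g   ≈⟨ fold-reindex g g-cong (Uniqueₚ.map⁺ S S f-inj u) u image⊆ ⊆image ⟩
      fold xs g           ∎
      where
      import Data.List.Relation.Unary.Unique.Setoid.Properties as Uniqueₚ
      open import Data.List.Membership.Setoid.Properties using (∈-map⁻; ∈-map⁺; ∈-resp-≈)
      image⊆ : map f xs ⊆ xs
      image⊆ y∈ with ∈-map⁻ S S y∈
      ... | x , x∈xs , y≈fx = ∈-resp-≈ S (symₛ y≈fx) (into x∈xs)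
      ⊆image : xs ⊆ map f xs
      ⊆image y∈xs with onto y∈xs
      ... | x , x∈xs , y≈fx = ∈-resp-≈ S (symₛ y≈fx) (∈-map⁺ S S f-cong x∈xs)

  module _ {s ℓs} (S : DecSetoid s ℓs) where
    open DecSetoid S using (_≟_) renaming (Carrier to E; _≈_ to _≈ₛ_; sym to symₛ; trans to transₛ; setoid to Sₛ)
    open import Data.List.Membership.Setoid Sₛ using (_∈_)
    open import Data.List.Relation.Unary.Unique.Setoid Sₛ using (Unique)

    fold-indicator : ∀ {xs z} (h : E → R) → (∀ {x y} → x ≈ₛ y → h x ≈ h y) → Unique xs → z ∈ xs →
                     fold xs (λ x → if does (x ≟ z) then h x else ε) ≈ h z
    fold-indicator {x ∷ xs} {z} h h-cong (x≉ ∷ u) z∈ with x ≟ z | z∈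
    ... | yes x≈z | _ = begin
      h x ∙ fold xs _   ≈⟨ ∙-cong (h-cong x≈z) (trans (fold-cong-All (All.map others x≉)) (fold-ε xs)) ⟩
      h z ∙ ε           ≈⟨ identityʳ (h z) ⟩
      h z               ∎
      where
      others : ∀ {w} → ¬ x ≈ₛ w → (if does (w ≟ z) then h w else ε) ≈ ε
      others {w} x≉w with w ≟ z
      ... | yes w≈z = ⊥-elim (x≉w (transₛ x≈z (symₛ w≈z)))
      ... | no  _   = refl
    ... | no x≉z | here z≈x     = ⊥-elim (x≉z (symₛ z≈x))
    ... | no x≉z | there z∈xs   = trans (identityˡ _) (fold-indicator h h-cong u z∈xs)

module FieldArithmetic {c ℓ} (F : FiniteField c ℓ) (q : ℕ) where
  open FiniteField F
  open FiniteFieldNotions F q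
  open import Relation.Binary.Reasoning.Setoid setoid
  open import Algebra.Properties.Ring ring public
    using (-‿distribˡ-*; -‿distribʳ-*; -‿involutive; -0#≈0#; -‿+-comm; +-inverseʳ-unique;
           x[y-z]≈xy-xz; [y-z]x≈yx-zx; x∙y⁻¹≈ε⇒x≈y; x≈y⇒x∙y⁻¹≈ε)
  open import Algebra.Properties.CommutativeSemigroup +-commutativeSemigroup public
    using () renaming (interchange to +-interchange; x∙yz≈y∙xz to x+yz≈y+xz)
  open import Algebra.Properties.CommutativeSemigroup *-commutativeSemigroup public
    using () renaming (interchange to *-interchange; x∙yz≈y∙xz to x*yz≈y*xz; x∙yz≈z∙xy to x*yz≈z*xy)

  #F : ℕ
  #F = length elems

  decSetoid : DecSetoid c ℓ
  decSetoid = record { isDecEquivalence = record { isEquivalence = isEquivalence ; _≟_ = _≟_ } }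

  if-yes : ∀ {p} {P : Set p} (P? : Dec P) {u v : Carrier} → P → (if does P? then u else v) ≈ u
  if-yes (yes _) _ = refl
  if-yes (no ¬p) p = ⊥-elim (¬p p)

  if-no : ∀ {p} {P : Set p} (P? : Dec P) {u v : Carrier} → ¬ P → (if does P? then u else v) ≈ v
  if-no (yes p) ¬p = ⊥-elim (¬p p)
  if-no (no _)  _  = refl

  x-y+y≈x : ∀ x y → x - y + y ≈ x
  x-y+y≈x x y = trans (+-assoc x (- y) y) (trans (+-congˡ (-‿inverseˡ y)) (+-identityʳ x))

  [_≡_]_ : ℕ → ℕ → Carrier → Carrier
  [ i ≡ k ] u = if does (i ℕ.≟ k) then u else 0#

  1≉0 : 1# ≉ 0#
  1≉0 1≈0 = 0≉1 (sym 1≈0)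

  x*y≈0⇒y≈0 : ∀ {x y} → x ≉ 0# → x * y ≈ 0# → y ≈ 0#
  x*y≈0⇒y≈0 {x} {y} x≉0 xy≈0 with inverse x x≉0
  ... | x⁻¹ , xx⁻¹≈1 = begin
    y               ≈⟨ *-identityˡ y ⟨
    1# * y          ≈⟨ *-congʳ (trans (*-comm x⁻¹ x) xx⁻¹≈1) ⟨
    (x⁻¹ * x) * y   ≈⟨ *-assoc x⁻¹ x y ⟩
    x⁻¹ * (x * y)   ≈⟨ *-congˡ xy≈0 ⟩
    x⁻¹ * 0#        ≈⟨ zeroʳ x⁻¹ ⟩
    0#              ∎

  *-≉0 : ∀ {x y} → x ≉ 0# → y ≉ 0# → x * y ≉ 0#
  *-≉0 x≉0 y≉0 xy≈0 = y≉0 (x*y≈0⇒y≈0 x≉0 xy≈0)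

  *-cancelˡ-≉0 : ∀ {x y z} → x ≉ 0# → x * y ≈ x * z → y ≈ z
  *-cancelˡ-≉0 {x} {y} {z} x≉0 xy≈xz =
    x∙y⁻¹≈ε⇒x≈y y z (x*y≈0⇒y≈0 x≉0 (trans (x[y-z]≈xy-xz x y z) (x≈y⇒x∙y⁻¹≈ε xy≈xz)))

  ∃-solution : ∀ {y} → y ≉ 0# → ∀ z → ∃ λ x → z ≈ y * x
  ∃-solution {y} y≉0 z with inverse y y≉0
  ... | y⁻¹ , yy⁻¹≈1 = y⁻¹ * z , sym (trans (sym (*-assoc y y⁻¹ z)) (trans (*-congʳ yy⁻¹≈1) (*-identityˡ z)))

  pow-cong : ∀ {x y} m → x ≈ y → pow x m ≈ pow y m
  pow-cong zero    x≈y = refl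
  pow-cong (suc m) x≈y = *-cong x≈y (pow-cong m x≈y)

  pow-+ : ∀ x m n → pow x (m ℕ.+ n) ≈ pow x m * pow x n
  pow-+ x zero    n = sym (*-identityˡ _)
  pow-+ x (suc m) n = trans (*-congˡ (pow-+ x m n)) (sym (*-assoc x _ _))

  pow-distrib-* : ∀ x y m → pow (x * y) m ≈ pow x m * pow y m
  pow-distrib-* x y zero    = sym (*-identityˡ 1#)
  pow-distrib-* x y (suc m) = trans (*-congˡ (pow-distrib-* x y m)) (*-interchange x y _ _)

  pow-1# : ∀ m → pow 1# m ≈ 1#
  pow-1# zero    = refl
  pow-1# (suc m) = trans (*-identityˡ _) (pow-1# m)

  pow-0# : ∀ m → 0 < m → pow 0# m ≈ 0#
  pow-0# (suc m) _ = zeroˡ _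

  pow-* : ∀ x m n → pow x (m ℕ.* n) ≈ pow (pow x m) n
  pow-* x zero    n = sym (pow-1# n)
  pow-* x (suc m) n = begin
    pow x (n ℕ.+ m ℕ.* n)        ≈⟨ pow-+ x n (m ℕ.* n) ⟩
    pow x n * pow x (m ℕ.* n)    ≈⟨ *-congˡ (pow-* x m n) ⟩
    pow x n * pow (pow x m) n    ≈⟨ pow-distrib-* x (pow x m) n ⟨
    pow (x * pow x m) n          ∎

  pow-≉0 : ∀ {x} m → x ≉ 0# → pow x m ≉ 0#
  pow-≉0 zero    x≉0 = 1≉0
  pow-≉0 (suc m) x≉0 = *-≉0 x≉0 (pow-≉0 m x≉0)

  pow≈0⇒≈0 : ∀ {x} m → pow x m ≈ 0# → x ≈ 0#
  pow≈0⇒≈0 {x} m xᵐ≈0 with x ≟ 0#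
  ... | yes x≈0 = x≈0
  ... | no  x≉0 = ⊥-elim (pow-≉0 m x≉0 xᵐ≈0)

  cast-+ : ∀ m n → cast (m ℕ.+ n) ≈ cast m + cast n
  cast-+ zero    n = sym (+-identityˡ _)
  cast-+ (suc m) n = trans (+-congˡ (cast-+ m n)) (sym (+-assoc 1# _ _))

  cast-* : ∀ m n → cast (m ℕ.* n) ≈ cast m * cast n
  cast-* zero    n = sym (zeroˡ _)
  cast-* (suc m) n = begin
    cast (n ℕ.+ m ℕ.* n)             ≈⟨ cast-+ n (m ℕ.* n) ⟩
    cast n + cast (m ℕ.* n)          ≈⟨ +-cong (sym (*-identityˡ (cast n))) (cast-* m n) ⟩
    1# * cast n + cast m * cast n    ≈⟨ distribʳ (cast n) 1# (cast m) ⟨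
    (1# + cast m) * cast n           ∎

  cast-^ : ∀ m n → cast (m ^ n) ≈ pow (cast m) n
  cast-^ m zero    = +-identityʳ 1#
  cast-^ m (suc n) = trans (cast-* m (m ^ n)) (*-congˡ (cast-^ m n))

  -- ΣL is, definitionally, BigOperators.fold for the additive monoid.
  open BigOperators +-commutativeMonoid public using () renaming
    ( fold-cong to ΣL-cong; fold-cong-All to ΣL-cong-All; fold-map to ΣL-map; fold-∙ to ΣL-+
    ; fold-ε to ΣL-0#; fold-comm to ΣL-comm; fold-concatMap to ΣL-concatMap
    ; fold-reindex to ΣL-reindex; fold-∘-bijection to ΣL-∘-bijection; fold-indicator to ΣL-indicator)

  ΠL : ∀ {a} {A : Set a} → List A → (A → Carrier) → Carrier
  ΠL = BigOperators.fold *-commutativeMonoid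

  open BigOperators *-commutativeMonoid public using () renaming (fold-∘-bijection to ΠL-∘-bijection)

  module _ {a} {A : Set a} where
    ΣL-distribˡ : ∀ (xs : List A) k g → k * ΣL xs g ≈ ΣL xs (λ x → k * g x)
    ΣL-distribˡ []       k g = zeroʳ k
    ΣL-distribˡ (x ∷ xs) k g = trans (distribˡ k _ _) (+-congˡ (ΣL-distribˡ xs k g))

    ΣL-distribʳ : ∀ (xs : List A) k g → ΣL xs g * k ≈ ΣL xs (λ x → g x * k)
    ΣL-distribʳ xs k g = trans (*-comm _ k) (trans (ΣL-distribˡ xs k g) (ΣL-cong xs (λ x → *-comm k (g x))))

    ΣL-neg : ∀ (xs : List A) g → - ΣL xs g ≈ ΣL xs (λ x → - g x)
    ΣL-neg []       g = -0#≈0#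
    ΣL-neg (x ∷ xs) g = trans (sym (-‿+-comm _ _)) (+-congˡ (ΣL-neg xs g))

    ΣL-const : ∀ (xs : List A) k → ΣL xs (λ _ → k) ≈ cast (length xs) * k
    ΣL-const []       k = sym (zeroˡ k)
    ΣL-const (x ∷ xs) k = trans (+-cong (sym (*-identityˡ k)) (ΣL-const xs k)) (sym (distribʳ k 1# _))

    ΣL-filter : ∀ {p} {P : A → Set p} (P? : Relation.Unary.Decidable P) xs g →
                ΣL (filter P? xs) g ≈ ΣL xs (λ x → if does (P? x) then g x else 0#)
    ΣL-filter P? []       g = refl
    ΣL-filter P? (x ∷ xs) g with does (P? x)
    ... | true  = +-congˡ (ΣL-filter P? xs g)
    ... | false = trans (ΣL-filter P? xs g) (sym (+-identityˡ _))

    ΠL-scale : ∀ (xs : List A) y g → ΠL xs (λ x → y * g x) ≈ pow y (length xs) * ΠL xs g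
    ΠL-scale []       y g = sym (*-identityˡ 1#)
    ΠL-scale (x ∷ xs) y g = trans (*-congˡ (ΠL-scale xs y g)) (*-interchange _ _ _ _)

    ΠL-≉0 : ∀ {xs : List A} g → All (λ x → g x ≉ 0#) xs → ΠL xs g ≉ 0#
    ΠL-≉0 g []            = 1≉0
    ΠL-≉0 g (gx≉0 ∷ gxs) = *-≉0 gx≉0 (ΠL-≉0 g gxs)

  ΣL-upTo-suc : ∀ n (h : ℕ → Carrier) → ΣL (upTo (suc n)) h ≈ ΣL (upTo n) h + h n
  ΣL-upTo-suc n h = go id n
    where
    open import Function using (id)
    go : ∀ (f : ℕ → ℕ) n → ΣL (applyUpTo f (suc n)) h ≈ ΣL (applyUpTo f n) h + h (f n)
    go f zero    = trans (+-identityʳ _) (sym (+-identityˡ _))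
    go f (suc n) = trans (+-congˡ (go (f ∘ suc) n)) (sym (+-assoc _ _ _))

  ΣL-upTo-indicator : ∀ {n k} (h : ℕ → Carrier) → k < n →
                      ΣL (upTo n) (λ i → [ i ≡ k ] h i) ≈ h k
  ΣL-upTo-indicator {n} h k<n = ΣL-indicator ℕP.≡-decSetoid h (λ { ≡.refl → refl }) (upTo⁺ n) (∈-upTo⁺ k<n)
    where
    open import Data.List.Relation.Unary.Unique.Propositional.Properties using (upTo⁺)
    open import Data.List.Membership.Propositional.Properties using (∈-upTo⁺)

  ΣL-upTo-vanishing : ∀ m n (h : ℕ → Carrier) → m ≤ n → (∀ i → m ≤ i → h i ≈ 0#) →
                      ΣL (upTo n) h ≈ ΣL (upTo m) h
  ΣL-upTo-vanishing m zero    h z≤n      _     = refl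
  ΣL-upTo-vanishing m (suc n) h m≤1+n    h≈0 with m ℕ.≟ suc n
  ... | yes ≡.refl = refl
  ... | no  m≢1+n  = begin
    ΣL (upTo (suc n)) h     ≈⟨ ΣL-upTo-suc n h ⟩
    ΣL (upTo n) h + h n     ≈⟨ +-cong (ΣL-upTo-vanishing m n h m≤n h≈0) (h≈0 n m≤n) ⟩
    ΣL (upTo m) h + 0#      ≈⟨ +-identityʳ _ ⟩
    ΣL (upTo m) h           ∎
    where m≤n = ℕP.≤-pred (ℕP.≤∧≢⇒< m≤1+n m≢1+n)

module Polynomials {c ℓ} (F : FiniteField c ℓ) (q : ℕ) where
  open FiniteField F
  open FiniteFieldNotions F q
  open FieldArithmetic F q
  open import Relation.Binary.Reasoning.Setoid setoid
  open import Data.List.Relation.Unary.Unique.Setoid setoid using (Unique)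

  horner : ∀ {d} → Vec Carrier d → Carrier → Carrier
  horner []       x = 0#
  horner (k ∷ cs) x = k + x * horner cs x

  DegreeBelow : ℕ → (Carrier → Carrier) → Set (c ⊔ ℓ)
  DegreeBelow d g = ∃ λ (cs : Vec Carrier d) → ∀ x → g x ≈ horner cs x

  withLeading : ∀ {d} → Vec Carrier d → Carrier → Carrier → Carrier
  withLeading {d} cs l x = horner cs x + l * pow x d

  withLeading-∷ : ∀ {d} k (cs : Vec Carrier d) l x → withLeading (k ∷ cs) l x ≈ k + x * withLeading cs l x
  withLeading-∷ {d} k cs l x = begin
    (k + x * horner cs x) + l * (x * pow x d)   ≈⟨ +-assoc k _ _ ⟩
    k + (x * horner cs x + l * (x * pow x d))   ≈⟨ +-congˡ (+-congˡ (x*yz≈y*xz l x _)) ⟩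
    k + (x * horner cs x + x * (l * pow x d))   ≈⟨ +-congˡ (distribˡ x _ _) ⟨
    k + x * withLeading cs l x                  ∎

  private
    -- one step of synthetic division by x - r, in Horner form
    division-step : ∀ k x r Q K → k + x * ((x - r) * Q + K) ≈ (x - r) * (K + x * Q) + (k + r * K)
    division-step k x r Q K = begin
      k + x * ((x - r) * Q + K)                          ≈⟨ +-congˡ (distribˡ x _ K) ⟩
      k + (x * ((x - r) * Q) + x * K)                    ≈⟨ +-congˡ (+-cong (x*yz≈y*xz x (x - r) Q) x*K) ⟩
      k + ((x - r) * (x * Q) + ((x - r) * K + r * K))    ≈⟨ +-congˡ (+-assoc _ _ _) ⟨
      k + (((x - r) * (x * Q) + (x - r) * K) + r * K)    ≈⟨ +-congˡ (+-congʳ (trans (distribˡ (x - r) K (x * Q)) (+-comm _ _))) ⟨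
      k + ((x - r) * (K + x * Q) + r * K)                ≈⟨ x+yz≈y+xz k _ _ ⟩
      (x - r) * (K + x * Q) + (k + r * K)                ∎
      where
      x*K : x * K ≈ (x - r) * K + r * K
      x*K = begin
        x * K                  ≈⟨ *-congʳ (x-y+y≈x x r) ⟨
        (x - r + r) * K        ≈⟨ distribʳ K (x - r) r ⟩
        (x - r) * K + r * K    ∎

  division : ∀ {d} (cs : Vec Carrier (suc d)) l r →
             ∃ λ (qs : Vec Carrier d) → ∀ x → withLeading cs l x ≈ (x - r) * withLeading qs l x + withLeading cs l r
  division {zero} (k ∷ []) l r = [] , λ x → begin
    withLeading (k ∷ []) l x                               ≈⟨ withLeading-∷ k [] l x ⟩
    k + x * K                                       ≈⟨ +-congˡ (*-congˡ (trans (sym (+-identityˡ K)) (+-congʳ (sym (zeroʳ (x - r)))))) ⟩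
    k + x * ((x - r) * 0# + K)                      ≈⟨ division-step k x r 0# K ⟩
    (x - r) * (K + x * 0#) + (k + r * K)            ≈⟨ +-cong (*-congˡ (trans (+-congˡ (zeroʳ x)) (+-identityʳ K))) (sym (withLeading-∷ k [] l r)) ⟩
    (x - r) * K + withLeading (k ∷ []) l r                 ∎
    where K = 0# + l * 1#
  division {suc d} (k ∷ cs) l r with division cs l r
  ... | qs , cs≈ = withLeading cs l r ∷ qs , λ x → begin
    withLeading (k ∷ cs) l x                                               ≈⟨ withLeading-∷ k cs l x ⟩
    k + x * withLeading cs l x                                             ≈⟨ +-congˡ (*-congˡ (cs≈ x)) ⟩
    k + x * ((x - r) * withLeading qs l x + withLeading cs l r)                   ≈⟨ division-step k x r _ _ ⟩
    (x - r) * (withLeading cs l r + x * withLeading qs l x) + (k + r * withLeading cs l r)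
      ≈⟨ +-cong (*-congˡ (withLeading-∷ _ qs l x)) (withLeading-∷ k cs l r) ⟨
    (x - r) * withLeading (withLeading cs l r ∷ qs) l x + withLeading (k ∷ cs) l r       ∎

  withLeading-roots-bound : ∀ {d} (cs : Vec Carrier d) {l} → l ≉ 0# → ∀ {rs} → Unique rs →
                     All (λ r → withLeading cs l r ≈ 0#) rs → length rs ≤ d
  withLeading-roots-bound cs l≉0 {[]} _ _ = z≤n
  withLeading-roots-bound [] {l} l≉0 {r ∷ rs} _ (lr≈0 ∷ _) =
    ⊥-elim (l≉0 (trans (sym (*-identityʳ l)) (trans (sym (+-identityˡ _)) lr≈0)))
  withLeading-roots-bound {suc d} cs {l} l≉0 {r ∷ rs} (r≉ ∷ u) (r≈0 ∷ rs≈0) with division cs l r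
  ... | qs , cs≈ = s≤s (withLeading-roots-bound qs l≉0 u (All.zipWith root-of-quotient (r≉ , rs≈0)))
    where
    root-of-quotient : ∀ {r′} → r ≉ r′ × withLeading cs l r′ ≈ 0# → withLeading qs l r′ ≈ 0#
    root-of-quotient {r′} (r≉r′ , r′≈0) = x*y≈0⇒y≈0 (λ r′-r≈0 → r≉r′ (sym (x∙y⁻¹≈ε⇒x≈y r′ r r′-r≈0))) (begin
      (r′ - r) * withLeading qs l r′                 ≈⟨ +-identityʳ _ ⟨
      (r′ - r) * withLeading qs l r′ + 0#            ≈⟨ +-congˡ r≈0 ⟨
      (r′ - r) * withLeading qs l r′ + withLeading cs l r   ≈⟨ cs≈ r′ ⟨
      withLeading cs l r′                            ≈⟨ r′≈0 ⟩
      0#                                      ∎)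

  roots-bound : ∀ {d g} → DegreeBelow d g → ∀ {l} → l ≉ 0# → ∀ {rs} → Unique rs →
                All (λ r → g r + l * pow r d ≈ 0#) rs → length rs ≤ d
  roots-bound (cs , g≈) l≉0 u rs≈0 = withLeading-roots-bound cs l≉0 u (All.map (trans (+-congʳ (sym (g≈ _)))) rs≈0)

  degreeBelow-cong : ∀ {d g h} → (∀ x → g x ≈ h x) → DegreeBelow d g → DegreeBelow d h
  degreeBelow-cong g≈h (cs , g≈) = cs , λ x → trans (sym (g≈h x)) (g≈ x)

  degreeBelow-0# : ∀ d → DegreeBelow d (λ _ → 0#)
  degreeBelow-0# zero    = [] , λ x → refl
  degreeBelow-0# (suc d) with degreeBelow-0# d
  ... | cs , 0≈ = 0# ∷ cs , λ x → sym (trans (+-identityˡ _) (trans (*-congˡ (sym (0≈ x))) (zeroʳ x)))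

  degreeBelow-+ : ∀ {d g h} → DegreeBelow d g → DegreeBelow d h → DegreeBelow d (λ x → g x + h x)
  degreeBelow-+ (cs , g≈) (ds , h≈) = Vec.zipWith _+_ cs ds , λ x → trans (+-cong (g≈ x) (h≈ x)) (horner-+ cs ds x)
    where
    horner-+ : ∀ {d} (cs ds : Vec Carrier d) x → horner cs x + horner ds x ≈ horner (Vec.zipWith _+_ cs ds) x
    horner-+ []       []       x = +-identityˡ 0#
    horner-+ (a ∷ cs) (b ∷ ds) x = trans (+-interchange a _ b _)
      (+-congˡ (trans (sym (distribˡ x _ _)) (*-congˡ (horner-+ cs ds x))))

  degreeBelow-monomial : ∀ k {e d} → e < d → DegreeBelow d (λ x → k * pow x e)
  degreeBelow-monomial k {zero} {suc d} _ with degreeBelow-0# d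
  ... | cs , 0≈ = k ∷ cs , λ x → trans (*-identityʳ k)
                                  (sym (trans (+-congˡ (trans (*-congˡ (sym (0≈ x))) (zeroʳ x))) (+-identityʳ k)))
  degreeBelow-monomial k {suc e} {suc d} (s≤s e<d) with degreeBelow-monomial k e<d
  ... | cs , kxᵉ≈ = 0# ∷ cs , λ x → begin
    k * (x * pow x e)    ≈⟨ x*yz≈y*xz k x _ ⟩
    x * (k * pow x e)    ≈⟨ *-congˡ (kxᵉ≈ x) ⟩
    x * horner cs x      ≈⟨ +-identityˡ _ ⟨
    0# + x * horner cs x ∎

module FiniteFieldOrder {c ℓ} (F : FiniteField c ℓ) (q : ℕ) where
  open FiniteField F
  open FiniteFieldNotions F q
  open FieldArithmetic F q
  open Polynomials F q
  open import Relation.Binary.Reasoning.Setoid setoid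
  open import Data.List.Membership.Setoid setoid using (_∈_)
  open import Data.List.Relation.Unary.Unique.Setoid setoid using (Unique)
  import Data.List.Relation.Unary.Unique.Setoid.Properties as Uniqueₚ
  open import Data.List.Membership.Setoid.Properties using (∈-filter⁺)
  open import Relation.Nullary using (¬?)
  open import Function using (id)
  open import Data.Nat.Combinatorics using (_C_; nCn≡1)
  open import Data.Nat.Primality using (Prime; ¬prime[0])
  open import Data.Nat.Divisibility using (_∣_; divides)

  -- Translation by 1 permutes F, so Σ x = Σ (x + 1) = Σ x + #F · 1.
  cast-#F≈0 : cast #F ≈ 0#
  cast-#F≈0 = +-cancelˡ S (cast #F) 0# (begin
    S + cast #F                ≈⟨ +-congˡ (trans (sym (*-identityʳ _)) (sym (ΣL-const elems 1#))) ⟩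
    S + ΣL elems (λ _ → 1#)    ≈⟨ ΣL-+ elems id (λ _ → 1#) ⟨
    ΣL elems (λ x → x + 1#)    ≈⟨ ΣL-∘-bijection setoid (_+ 1#) id id +-congʳ (+-cancelʳ 1# _ _) distinct
                                   (λ _ → complete _) (λ {y} _ → y - 1# , complete _ , sym (x-y+y≈x y 1#)) ⟩
    S                          ≈⟨ +-identityʳ S ⟨
    S + 0#                     ∎)
    where
    S = ΣL elems id
    open import Algebra.Properties.Ring ring using (+-cancelˡ; +-cancelʳ)

  nonzeros : List Carrier
  nonzeros = filter (λ x → ¬? (x ≟ 0#)) elems

  nonzeros-unique : Unique nonzeros
  nonzeros-unique = Uniqueₚ.filter⁺ setoid _ distinct

  nonzeros-≉0 : All (_≉ 0#) nonzeros
  nonzeros-≉0 = Allₚ.all-filter _ elems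

  ∈-nonzeros : ∀ {x} → x ≉ 0# → x ∈ nonzeros
  ∈-nonzeros {x} x≉0 = ∈-filter⁺ setoid _ (λ x≈y x≉0 y≈0 → x≉0 (trans x≈y y≈0)) (complete x) x≉0

  length-nonzeros : suc (length nonzeros) ≡ #F
  length-nonzeros = length-filter-≉ decSetoid distinct (complete 0#)

  ∈-nonzeros⁻ : ∀ {x} → x ∈ nonzeros → x ≉ 0#
  ∈-nonzeros⁻ x∈ = proj₂ (∈-filter⁻ setoid _ (λ x≈y x≉0 y≈0 → x≉0 (trans x≈y y≈0)) {xs = elems} x∈)
    where open import Data.List.Membership.Setoid.Properties using (∈-filter⁻)

  #F∸1≡ : #F ∸ 1 ≡ length nonzeros
  #F∸1≡ = ≡.cong (_∸ 1) (≡.sym length-nonzeros)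

  #F∸1>0 : 0 < #F ∸ 1
  #F∸1>0 = ≡.subst (0 <_) (≡.sym #F∸1≡) (nonempty (∈-nonzeros 1≉0))
    where
    nonempty : ∀ {x xs} → x ∈ xs → 0 < length xs
    nonempty {xs = _ ∷ _} _ = s≤s z≤n

  -- Multiplication by y permutes the nonzero elements, so y^(#F-1) Π x = Π (y x) = Π x.
  fermat : ∀ {y} → y ≉ 0# → pow y (#F ∸ 1) ≈ 1#
  fermat {y} y≉0 = ≡.subst (λ k → pow y k ≈ 1#) (≡.sym #F∸1≡) (*-cancelˡ-≉0 P≉0 (begin
    P * pow y (length nonzeros)    ≈⟨ *-comm P _ ⟩
    pow y (length nonzeros) * P    ≈⟨ ΠL-scale nonzeros y id ⟨
    ΠL nonzeros (y *_)             ≈⟨ ΠL-∘-bijection setoid (y *_) id id *-congˡ (*-cancelˡ-≉0 y≉0) nonzeros-unique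
                                        (λ x∈ → ∈-nonzeros (*-≉0 y≉0 (∈-nonzeros⁻ x∈))) onto ⟩
    P                              ≈⟨ *-identityʳ P ⟨
    P * 1#                         ∎))
    where
    P = ΠL nonzeros id
    P≉0 : P ≉ 0#
    P≉0 = ΠL-≉0 id nonzeros-≉0
    onto : ∀ {w} → w ∈ nonzeros → ∃ λ x → x ∈ nonzeros × w ≈ y * x
    onto {w} w∈ with ∃-solution y≉0 w
    ... | x , w≈yx = x , ∈-nonzeros (λ x≈0 → ∈-nonzeros⁻ w∈ (trans w≈yx (trans (*-congˡ x≈0) (zeroʳ y)))) , w≈yx

  pow-#F : ∀ x → pow x #F ≈ x
  pow-#F x = ≡.subst (λ k → pow x k ≈ x) length-nonzeros (x*xᴺ≈x (x ≟ 0#))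
    where
    x*xᴺ≈x : Dec (x ≈ 0#) → x * pow x (length nonzeros) ≈ x
    x*xᴺ≈x (yes x≈0) = trans (*-congʳ x≈0) (trans (zeroˡ _) (sym x≈0))
    x*xᴺ≈x (no  x≉0) = trans (*-congˡ (≡.subst (λ k → pow x k ≈ 1#) #F∸1≡ (fermat x≉0))) (*-identityʳ x)

  private
    nonzero-witness : ∀ {p} {P : Carrier → Set p} {P? : Relation.Unary.Decidable P} →
                      ¬ All P nonzeros → ∃ λ y → y ≉ 0# × ¬ P y
    nonzero-witness {P? = P?} ¬all = All.lookupWith (λ {y} y≉0 ¬Py → y , y≉0 , ¬Py) nonzeros-≉0
                                       (Allₚ.¬All⇒Any¬ P? nonzeros ¬all)

  -- Some y ≠ 0 has y^e ≠ 1, since x^e = 1 has at most e roots, and y^e Σ x^e = Σ (y x)^e = Σ x^e.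
  Σpow-below : ∀ {e} → e < #F ∸ 1 → ΣL elems (λ x → pow x e) ≈ 0#
  Σpow-below {zero}  _   = trans (ΣL-const elems 1#) (trans (*-identityʳ _) cast-#F≈0)
  Σpow-below {suc e} e<N with All.all? (λ y → pow y (suc e) ≟ 1#) nonzeros
  ... | yes all≈1 = ⊥-elim (ℕP.<⇒≱ e<N (ℕP.≤-trans (ℕP.≤-reflexive #F∸1≡)
          (roots-bound (degreeBelow-monomial (- 1#) (s≤s z≤n)) 1≉0 nonzeros-unique
             (All.map (λ yᵉ≈1 → trans (+-cong (*-identityʳ _) (trans (*-identityˡ _) yᵉ≈1)) (-‿inverseˡ 1#)) all≈1))))
  ... | no ¬all≈1 with nonzero-witness {P? = λ y → pow y (suc e) ≟ 1#} ¬all≈1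
  ...   | y , y≉0 , yᵉ≉1 = x*y≈0⇒y≈0 (λ yᵉ-1≈0 → yᵉ≉1 (x∙y⁻¹≈ε⇒x≈y _ _ yᵉ-1≈0)) (begin
    (pow y (suc e) - 1#) * S          ≈⟨ [y-z]x≈yx-zx S _ 1# ⟩
    pow y (suc e) * S - 1# * S        ≈⟨ +-cong yᵉS≈S (-‿cong (*-identityˡ S)) ⟩
    S - S                             ≈⟨ -‿inverseʳ S ⟩
    0#                                ∎)
    where
    S = ΣL elems (λ x → pow x (suc e))
    yᵉS≈S : pow y (suc e) * S ≈ S
    yᵉS≈S = begin
      pow y (suc e) * S                      ≈⟨ ΣL-distribˡ elems _ _ ⟩
      ΣL elems (λ x → pow y (suc e) * pow x (suc e))  ≈⟨ ΣL-cong elems (λ x → sym (pow-distrib-* y x (suc e))) ⟩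
      ΣL elems (λ x → pow (y * x) (suc e))   ≈⟨ ΣL-∘-bijection setoid (y *_) (λ x → pow x (suc e)) (pow-cong (suc e)) *-congˡ
                                                 (*-cancelˡ-≉0 y≉0) distinct (λ _ → complete _)
                                                 (λ {w} _ → let x , w≈yx = ∃-solution y≉0 w in x , complete x , w≈yx) ⟩
      S                                      ∎

  Σpow-top : ΣL elems (λ x → pow x (#F ∸ 1)) ≈ - 1#
  Σpow-top = begin
    ΣL elems (λ x → pow x (#F ∸ 1))                    ≈⟨ ΣL-cong elems pow-top ⟩
    ΣL elems (λ x → 1# + - [x≈0] x)                     ≈⟨ ΣL-+ elems _ _ ⟩
    ΣL elems (λ _ → 1#) + ΣL elems (λ x → - [x≈0] x)    ≈⟨ +-cong (sym Σ1≈0) (ΣL-neg elems [x≈0]) ⟨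
    0# + - ΣL elems [x≈0]                               ≈⟨ +-identityˡ _ ⟩
    - ΣL elems [x≈0]                                    ≈⟨ -‿cong (ΣL-indicator decSetoid (λ _ → 1#) (λ _ → refl) distinct (complete 0#)) ⟩
    - 1#                                                ∎
    where
    Σ1≈0 : ΣL elems (λ _ → 1#) ≈ 0#
    Σ1≈0 = trans (ΣL-const elems 1#) (trans (*-identityʳ _) cast-#F≈0)
    [x≈0] : Carrier → Carrier
    [x≈0] x = if does (x ≟ 0#) then 1# else 0#
    pow-top : ∀ x → pow x (#F ∸ 1) ≈ 1# + - [x≈0] x
    pow-top x with x ≟ 0#
    ... | yes x≈0 = trans (pow-cong (#F ∸ 1) x≈0) (trans (pow-0# _ #F∸1>0) (sym (-‿inverseʳ 1#)))
    ... | no  x≉0 = trans (fermat x≉0) (sym (trans (+-congˡ -0#≈0#) (+-identityʳ 1#)))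

  Σpow-≢ : ∀ {e} → e < (#F ∸ 1) ℕ.+ (#F ∸ 1) → e ≢ #F ∸ 1 → ΣL elems (λ x → pow x e) ≈ 0#
  Σpow-≢ {e} e<2N e≢N with ℕP.<-cmp e (#F ∸ 1)
  ... | tri< e<N _ _   = Σpow-below e<N
  ... | tri≈ _ e≡N _   = ⊥-elim (e≢N e≡N)
  ... | tri> _ _ N<e   = trans (ΣL-cong elems reduce) (Σpow-below e∸N<N)
    where
    e∸N<N : e ∸ (#F ∸ 1) < #F ∸ 1
    e∸N<N = ℕP.+-cancelʳ-< (#F ∸ 1) _ _
              (≡.subst (_< (#F ∸ 1) ℕ.+ (#F ∸ 1)) (≡.sym (ℕP.m∸n+n≡m (ℕP.<⇒≤ N<e))) e<2N)
    reduce : ∀ x → pow x e ≈ pow x (e ∸ (#F ∸ 1))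
    reduce x with x ≟ 0#
    ... | yes x≈0 = trans (pow-cong e x≈0) (trans (pow-0# e (ℕP.<-trans #F∸1>0 N<e))
                      (sym (trans (pow-cong (e ∸ (#F ∸ 1)) x≈0) (pow-0# (e ∸ (#F ∸ 1)) (ℕP.m<n⇒0<n∸m N<e)))))
    ... | no  x≉0 = begin
      pow x e                                      ≡⟨ ≡.cong (pow x) (ℕP.m∸n+n≡m (ℕP.<⇒≤ N<e)) ⟨
      pow x (e ∸ (#F ∸ 1) ℕ.+ (#F ∸ 1))            ≈⟨ pow-+ x (e ∸ (#F ∸ 1)) (#F ∸ 1) ⟩
      pow x (e ∸ (#F ∸ 1)) * pow x (#F ∸ 1)        ≈⟨ *-congˡ (fermat x≉0) ⟩
      pow x (e ∸ (#F ∸ 1)) * 1#                    ≈⟨ *-identityʳ _ ⟩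
      pow x (e ∸ (#F ∸ 1))                         ∎

  Σpow : ∀ {i J} → i < #F → J < #F ∸ 1 →
         ΣL elems (λ x → pow x (i ℕ.+ J)) ≈ [ i ≡ #F ∸ 1 ∸ J ] (- 1#)
  Σpow {i} {J} i<#F J<N with i ℕ.≟ #F ∸ 1 ∸ J
  ... | yes i≡ = trans (≡.subst (λ e → ΣL elems (λ x → pow x e) ≈ - 1#)
                   (≡.sym (≡.trans (≡.cong (ℕ._+ J) i≡) (ℕP.m∸n+n≡m (ℕP.<⇒≤ J<N)))) Σpow-top) (sym (if-yes (i ℕ.≟ _) i≡))
  ... | no  i≢ = trans (Σpow-≢ (ℕP.+-mono-≤-< i≤N J<N) λ i+J≡N → i≢ (≡.trans (≡.sym (ℕP.m+n∸n≡m i J)) (≡.cong (_∸ J) i+J≡N)))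
                       (sym (if-no (i ℕ.≟ _) i≢))
    where
    i≤N : i ≤ #F ∸ 1
    i≤N = ℕP.≤-pred (ℕP.≤-trans i<#F (ℕP.≤-reflexive (≡.trans (≡.sym length-nonzeros) (≡.cong suc (≡.sym #F∸1≡)))))

  ΣL-polyFun*pow : ∀ a {J} → J < #F ∸ 1 → ΣL elems (λ x → polyFun #F a x * pow x J) ≈ - a (#F ∸ 1 ∸ J)
  ΣL-polyFun*pow a {J} J<N = begin
    ΣL elems (λ x → polyFun #F a x * pow x J)                     ≈⟨ ΣL-cong elems expand ⟩
    ΣL elems (λ x → ΣL (upTo #F) (λ i → a i * pow x (i ℕ.+ J)))  ≈⟨ ΣL-comm elems (upTo #F) _ ⟩
    ΣL (upTo #F) (λ i → ΣL elems (λ x → a i * pow x (i ℕ.+ J)))  ≈⟨ ΣL-cong-All (Allₚ.applyUpTo⁺₁ id #F summand) ⟩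
    ΣL (upTo #F) (λ i → [ i ≡ k ] (- a i))                        ≈⟨ ΣL-upTo-indicator (λ i → - a i) k<#F ⟩
    - a k                                                         ∎
    where
    k = #F ∸ 1 ∸ J
    k<#F : k < #F
    k<#F = ℕP.≤-trans (s≤s (ℕP.≤-trans (ℕP.m∸n≤m _ J) (ℕP.≤-reflexive #F∸1≡))) (ℕP.≤-reflexive length-nonzeros)
    expand : ∀ x → polyFun #F a x * pow x J ≈ ΣL (upTo #F) (λ i → a i * pow x (i ℕ.+ J))
    expand x = trans (ΣL-distribʳ (upTo #F) _ _) (ΣL-cong (upTo #F) λ i → trans (*-assoc _ _ _) (*-congˡ (sym (pow-+ x i J))))
    summand : ∀ {i} → i < #F → ΣL elems (λ x → a i * pow x (i ℕ.+ J)) ≈ [ i ≡ k ] (- a i)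
    summand {i} i<#F = trans (sym (ΣL-distribˡ elems (a i) _)) (trans (*-congˡ (Σpow i<#F J<N)) (scale (i ℕ.≟ k)))
      where
      scale : ∀ {p} {P : Set p} (P? : Dec P) → a i * (if does P? then - 1# else 0#) ≈ (if does P? then - a i else 0#)
      scale (yes _) = trans (sym (-‿distribʳ-* (a i) 1#)) (-‿cong (*-identityʳ _))
      scale (no  _) = zeroʳ _

  binomial : ∀ n x y → pow (x + y) n ≈ ΣL (upTo (suc n)) (λ i → cast (n C i) * (pow x i * pow y (n ∸ i)))
  binomial n x y = begin
    pow (x + y) n                                        ≡⟨ pow≡ (x + y) n ⟨
    RM._×_ *-rawMonoid n (x + y)                         ≈⟨ theorem n x y ⟩
    VF.foldr _+_ 0# {suc n} (λ k → RM._×_ +-rawMonoid (n C toℕ k) (RM._×_ *-rawMonoid (toℕ k) x * RM._×_ *-rawMonoid (n ∸ toℕ k) y))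
                                                         ≈⟨ foldr-cong (suc n) (λ k → trans (×≈cast* (n C toℕ k) _)
                                                              (*-congˡ (reflexive (≡.cong₂ _*_ (pow≡ x (toℕ k)) (pow≡ y (n ∸ toℕ k)))))) ⟩
    VF.foldr _+_ 0# {suc n} (λ k → cast (n C toℕ k) * (pow x (toℕ k) * pow y (n ∸ toℕ k)))
                                                         ≡⟨ foldr≡ΣL (suc n) id _ ⟩
    ΣL (upTo (suc n)) (λ i → cast (n C i) * (pow x i * pow y (n ∸ i))) ∎
    where
    open import Algebra.Properties.CommutativeSemiring.Binomial commutativeSemiring using (theorem)
    import Algebra.Definitions.RawMonoid as RM
    import Data.Vec.Functional as VF
    open import Data.Fin using (Fin; toℕ)
    pow≡ : ∀ x n → RM._×_ *-rawMonoid n x ≡ pow x n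
    pow≡ x zero    = ≡.refl
    pow≡ x (suc n) = ≡.cong (x *_) (pow≡ x n)
    ×≈cast* : ∀ n x → RM._×_ +-rawMonoid n x ≈ cast n * x
    ×≈cast* zero    x = sym (zeroˡ x)
    ×≈cast* (suc n) x = trans (+-cong (sym (*-identityˡ x)) (×≈cast* n x)) (sym (distribʳ x 1# (cast n)))
    foldr-cong : ∀ m {g h : Fin m → Carrier} → (∀ k → g k ≈ h k) → VF.foldr _+_ 0# g ≈ VF.foldr _+_ 0# h
    foldr-cong zero    g≈h = refl
    foldr-cong (suc m) g≈h = +-cong (g≈h Fin.zero) (foldr-cong m (g≈h ∘ Fin.suc))
      where import Data.Fin as Fin
    foldr≡ΣL : ∀ m (f : ℕ → ℕ) (g : ℕ → Carrier) → VF.foldr _+_ 0# {m} (λ k → g (f (toℕ k))) ≡ ΣL (applyUpTo f m) g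
    foldr≡ΣL zero    f g = ≡.refl
    foldr≡ΣL (suc m) f g = ≡.cong (g (f 0) +_) (foldr≡ΣL m (f ∘ suc) g)

  cast-char : ∀ {p e} → Prime p → #F ≡ p ^ e → cast p ≈ 0#
  cast-char {p} {e} _ #F≡pᵉ = pow≈0⇒≈0 e (trans (sym (cast-^ p e)) (trans (reflexive (≡.cong cast (≡.sym #F≡pᵉ))) cast-#F≈0))

  module _ {p} (p-prime : Prime p) (cast-p≈0 : cast p ≈ 0#) where

    binomial-prime-term : ∀ x y {i} → i ≤ p →
                          cast (p C i) * (pow x i * pow y (p ∸ i)) ≈ [ i ≡ p ] pow x p + [ i ≡ 0 ] pow y p
    binomial-prime-term x y {i} i≤p with i ℕ.≟ p | i ℕ.≟ 0
    ... | yes ≡.refl | yes ≡.refl = ⊥-elim (¬prime[0] p-prime)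
    ... | yes ≡.refl | no p≢0 = begin
      cast (p C p) * (pow x p * pow y (p ∸ p))
        ≈⟨ *-cong (reflexive (≡.cong cast (nCn≡1 p))) (*-congˡ (reflexive (≡.cong (pow y) (ℕP.n∸n≡0 p)))) ⟩
      (1# + 0#) * (pow x p * 1#)                ≈⟨ trans (*-congʳ (+-identityʳ 1#)) (trans (*-identityˡ _) (*-identityʳ _)) ⟩
      pow x p                                   ≈⟨ +-identityʳ _ ⟨
      pow x p + 0#                              ≈⟨ +-cong (if-yes (p ℕ.≟ p) ≡.refl) (if-no (p ℕ.≟ 0) p≢0) ⟨
      [ p ≡ p ] pow x p + [ p ≡ 0 ] pow y p     ∎
    ... | no 0≢p | yes ≡.refl = begin
      (1# + 0#) * (1# * pow y p)                ≈⟨ trans (*-congʳ (+-identityʳ 1#)) (trans (*-identityˡ _) (*-identityˡ _)) ⟩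
      pow y p                                   ≈⟨ +-identityˡ _ ⟨
      0# + pow y p                              ≈⟨ +-congʳ (if-no (0 ℕ.≟ p) 0≢p) ⟨
      [ 0 ≡ p ] pow x p + [ 0 ≡ 0 ] pow y p     ∎
    ... | no i≢p | no i≢0 = begin
      cast (p C i) * _
        ≈⟨ *-congʳ (cast-multiple (prime∣C p-prime (ℕP.n≢0⇒n>0 i≢0) (ℕP.≤∧≢⇒< i≤p i≢p))) ⟩
      0# * _                                    ≈⟨ zeroˡ _ ⟩
      0#                                        ≈⟨ +-identityˡ 0# ⟨
      0# + 0#                                   ≈⟨ +-cong (if-no (i ℕ.≟ p) i≢p) (if-no (i ℕ.≟ 0) i≢0) ⟨
      [ i ≡ p ] pow x p + [ i ≡ 0 ] pow y p     ∎
      where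
      cast-multiple : ∀ {k} → p ∣ k → cast k ≈ 0#
      cast-multiple (divides m ≡.refl) = trans (cast-* m p) (trans (*-congˡ cast-p≈0) (zeroʳ _))

    frobenius : ∀ x y → pow (x + y) p ≈ pow x p + pow y p
    frobenius x y = begin
      pow (x + y) p                                          ≈⟨ binomial p x y ⟩
      ΣL (upTo (suc p)) (λ i → cast (p C i) * (pow x i * pow y (p ∸ i)))
        ≈⟨ ΣL-cong-All (Allₚ.applyUpTo⁺₁ id (suc p) (λ i<1+p → binomial-prime-term x y (ℕP.≤-pred i<1+p))) ⟩
      ΣL (upTo (suc p)) (λ i → [ i ≡ p ] pow x p + [ i ≡ 0 ] pow y p)
        ≈⟨ ΣL-+ (upTo (suc p)) _ _ ⟩
      ΣL (upTo (suc p)) (λ i → [ i ≡ p ] pow x p) + ΣL (upTo (suc p)) (λ i → [ i ≡ 0 ] pow y p)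
        ≈⟨ +-cong (ΣL-upTo-indicator {suc p} {p} _ ℕP.≤-refl) (ΣL-upTo-indicator {suc p} {0} _ (s≤s z≤n)) ⟩
      pow x p + pow y p                                      ∎

    frobenius-^ : ∀ k x y → pow (x + y) (p ^ k) ≈ pow x (p ^ k) + pow y (p ^ k)
    frobenius-^ zero    x y = trans (*-identityʳ _) (sym (+-cong (*-identityʳ x) (*-identityʳ y)))
    frobenius-^ (suc k) x y = begin
      pow (x + y) (p ℕ.* p ^ k)                           ≈⟨ pow-* (x + y) p (p ^ k) ⟩
      pow (pow (x + y) p) (p ^ k)                         ≈⟨ pow-cong (p ^ k) (frobenius x y) ⟩
      pow (pow x p + pow y p) (p ^ k)                     ≈⟨ frobenius-^ k (pow x p) (pow y p) ⟩
      pow (pow x p) (p ^ k) + pow (pow y p) (p ^ k)     ≈⟨ +-cong (pow-* x p (p ^ k)) (pow-* y p (p ^ k)) ⟨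
      pow x (p ℕ.* p ^ k) + pow y (p ℕ.* p ^ k)         ∎

module Subfield {c ℓ} (F : FiniteField c ℓ) (q d : ℕ) (q-pp : IsPrimePower q)
                (#F≡ : length (FiniteField.elems F) ≡ q ^ suc d) where
  open FiniteField F
  open FiniteFieldNotions F q
  open FieldArithmetic F q
  open Polynomials F q
  open FiniteFieldOrder F q
  open import Relation.Binary.Reasoning.Setoid setoid
  open import Data.List.Membership.Setoid setoid using (_∈_)
  open import Data.List.Relation.Unary.Unique.Setoid setoid using (Unique)
  open import Data.List.Membership.Setoid.Properties using (∈-filter⁺)
  import Data.List.Relation.Unary.Unique.Setoid.Properties as Uniqueₚ
  open import Data.Nat.Primality using (Prime; prime⇒nonZero; prime⇒nonTrivial)

  private
    p = proj₁ q-pp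
    m = proj₁ (proj₂ q-pp)
    p-prime : Prime p
    p-prime = proj₁ (proj₂ (proj₂ q-pp))
    0<m : 0 < m
    0<m = proj₁ (proj₂ (proj₂ (proj₂ q-pp)))
    q≡pᵐ : q ≡ p ^ m
    q≡pᵐ = proj₂ (proj₂ (proj₂ (proj₂ q-pp)))
    cast-p≈0 : cast p ≈ 0#
    cast-p≈0 = cast-char {e = m ℕ.* suc d} p-prime (≡.trans #F≡ (≡.trans (≡.cong (_^ suc d) q≡pᵐ) (ℕP.^-*-assoc p m (suc d))))

  1<q : 1 < q
  1<q = ≡.subst (1 <_) (≡.sym q≡pᵐ) (ℕP.<-≤-trans 1<p (ℕP.≤-trans (ℕP.≤-reflexive (≡.sym (ℕP.*-identityʳ p)))
          (ℕP.^-monoʳ-≤ p {1} {m} 0<m)))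
    where
    instance _ = prime⇒nonZero p-prime
    1<p : 1 < p
    1<p = ℕ.nonTrivial⇒n>1 p {{prime⇒nonTrivial p-prime}}

  q-1+1≡q : suc (q ∸ 1) ≡ q
  q-1+1≡q = ℕP.suc-pred q {{ℕ.>-nonZero (ℕP.<-trans (s≤s z≤n) 1<q)}}

  cast-q≈0 : cast q ≈ 0#
  cast-q≈0 = ≡.subst (λ k → cast k ≈ 0#) (≡.sym q≡pᵐ) (trans (cast-^ p m) (pow≈0-of-0 m 0<m))
    where
    pow≈0-of-0 : ∀ k → 0 < k → pow (cast p) k ≈ 0#
    pow≈0-of-0 k 0<k = trans (pow-cong k cast-p≈0) (pow-0# k 0<k)

  frobenius-q : ∀ x y → pow (x + y) q ≈ pow x q + pow y q
  frobenius-q x y = ≡.subst (λ k → pow (x + y) k ≈ pow x k + pow y k) (≡.sym q≡pᵐ) (frobenius-^ p-prime cast-p≈0 m x y)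

  pow-qⁿ : ∀ x → pow x (q ^ suc d) ≈ x
  pow-qⁿ x = ≡.subst (λ k → pow x k ≈ x) #F≡ (pow-#F x)

  InFq-resp : ∀ {x y} → x ≈ y → InFq x → InFq y
  InFq-resp x≈y xᵠ≈x = trans (pow-cong q (sym x≈y)) (trans xᵠ≈x x≈y)

  InFq-0# : InFq 0#
  InFq-0# = pow-0# q (ℕP.<-trans (s≤s z≤n) 1<q)

  InFq-1# : InFq 1#
  InFq-1# = pow-1# q

  InFq-+ : ∀ {x y} → InFq x → InFq y → InFq (x + y)
  InFq-+ x∈ y∈ = trans (frobenius-q _ _) (+-cong x∈ y∈)

  InFq-* : ∀ {x y} → InFq x → InFq y → InFq (x * y)
  InFq-* x∈ y∈ = trans (pow-distrib-* _ _ q) (*-cong x∈ y∈)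

  InFq-neg : ∀ {x} → InFq x → InFq (- x)
  InFq-neg {x} x∈ = +-inverseʳ-unique x (pow (- x) q) (begin
    x + pow (- x) q          ≈⟨ +-congʳ x∈ ⟨
    pow x q + pow (- x) q    ≈⟨ frobenius-q x (- x) ⟨
    pow (x - x) q            ≈⟨ pow-cong q (-‿inverseʳ x) ⟩
    pow 0# q                 ≈⟨ InFq-0# ⟩
    0#                       ∎)

  InFq-− : ∀ {x y} → InFq x → InFq y → InFq (x - y)
  InFq-− x∈ y∈ = InFq-+ x∈ (InFq-neg y∈)

  InFq-inverse : ∀ {x y} → InFq x → x * y ≈ 1# → InFq y
  InFq-inverse {x} {y} x∈ xy≈1 = begin
    pow y q                  ≈⟨ *-identityˡ _ ⟨
    1# * pow y q             ≈⟨ *-congʳ (trans (*-comm y x) xy≈1) ⟨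
    (y * x) * pow y q        ≈⟨ *-assoc y x _ ⟩
    y * (x * pow y q)        ≈⟨ *-congˡ (*-congʳ x∈) ⟨
    y * (pow x q * pow y q)  ≈⟨ *-congˡ (pow-distrib-* x y q) ⟨
    y * pow (x * y) q        ≈⟨ *-congˡ (trans (pow-cong q xy≈1) (pow-1# q)) ⟩
    y * 1#                   ≈⟨ *-identityʳ y ⟩
    y                        ∎

  InFq-pow-q-1 : ∀ {x} → InFq x → x ≉ 0# → pow x (q ∸ 1) ≈ 1#
  InFq-pow-q-1 {x} x∈ x≉0 = *-cancelˡ-≉0 x≉0 (begin
    x * pow x (q ∸ 1)    ≡⟨ ≡.cong (pow x) q-1+1≡q ⟩
    pow x q              ≈⟨ x∈ ⟩
    x                    ≈⟨ *-identityʳ x ⟨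
    x * 1#               ∎)

  Fq-unique : Unique Fq
  Fq-unique = Uniqueₚ.filter⁺ setoid _ distinct

  Fq-InFq : All InFq Fq
  Fq-InFq = Allₚ.all-filter _ elems

  ∈-Fq : ∀ {x} → InFq x → x ∈ Fq
  ∈-Fq {x} x∈ = ∈-filter⁺ setoid _ (λ x≈y → InFq-resp x≈y) (complete x) x∈

  length-Fq≤q : length Fq ≤ q
  length-Fq≤q = roots-bound (degreeBelow-cong -x≈ (degreeBelow-monomial (- 1#) 1<q)) 1≉0 Fq-unique
                  (All.map (λ {x} xᵠ≈x → trans (+-congˡ (trans (*-identityˡ _) xᵠ≈x)) (-‿inverseˡ x)) Fq-InFq)
    where
    -x≈ : ∀ x → - 1# * pow x 1 ≈ - x
    -x≈ x = trans (sym (-‿distribˡ-* 1# _)) (-‿cong (trans (*-identityˡ _) (*-identityʳ x)))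

  tr : ℕ → Carrier → Carrier
  tr zero    z = 0#
  tr (suc k) z = z + tr k (pow z q)

  tr-cong : ∀ k {z w} → z ≈ w → tr k z ≈ tr k w
  tr-cong zero    z≈w = refl
  tr-cong (suc k) z≈w = +-cong z≈w (tr-cong k (pow-cong q z≈w))

  tr-suc : ∀ k z → tr (suc k) z ≈ tr k z + pow z (q ^ k)
  tr-suc zero    z = trans (+-identityʳ z) (trans (sym (*-identityʳ z)) (sym (+-identityˡ _)))
  tr-suc (suc k) z = begin
    z + tr (suc k) (pow z q)                               ≈⟨ +-congˡ (tr-suc k (pow z q)) ⟩
    z + (tr k (pow z q) + pow (pow z q) (q ^ k))         ≈⟨ +-assoc _ _ _ ⟨
    tr (suc k) z + pow (pow z q) (q ^ k)                 ≈⟨ +-congˡ (pow-* z q (q ^ k)) ⟨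
    tr (suc k) z + pow z (q ^ suc k)                     ∎

  tr-+ : ∀ k z w → tr k (z + w) ≈ tr k z + tr k w
  tr-+ zero    z w = sym (+-identityˡ 0#)
  tr-+ (suc k) z w = begin
    (z + w) + tr k (pow (z + w) q)                 ≈⟨ +-congˡ (tr-cong k (frobenius-q z w)) ⟩
    (z + w) + tr k (pow z q + pow w q)             ≈⟨ +-congˡ (tr-+ k _ _) ⟩
    (z + w) + (tr k (pow z q) + tr k (pow w q))    ≈⟨ +-interchange _ _ _ _ ⟩
    tr (suc k) z + tr (suc k) w                    ∎

  tr-scale : ∀ k {t} → InFq t → ∀ z → tr k (t * z) ≈ t * tr k z
  tr-scale zero    t∈ z = sym (zeroʳ _)
  tr-scale (suc k) {t} t∈ z = begin
    t * z + tr k (pow (t * z) q)     ≈⟨ +-congˡ (tr-cong k (trans (pow-distrib-* t z q) (*-congʳ t∈))) ⟩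
    t * z + tr k (t * pow z q)       ≈⟨ +-congˡ (tr-scale k t∈ _) ⟩
    t * z + t * tr k (pow z q)       ≈⟨ distribˡ t _ _ ⟨
    t * tr (suc k) z                 ∎

  tr-0# : ∀ k → tr k 0# ≈ 0#
  tr-0# k = trans (tr-cong k (sym (zeroˡ 0#))) (trans (tr-scale k InFq-0# 0#) (zeroˡ _))

  tr-− : ∀ k z w → tr k (z - w) ≈ tr k z - tr k w
  tr-− k z w = trans (tr-+ k z (- w)) (+-congˡ tr-neg)
    where
    tr-neg : tr k (- w) ≈ - tr k w
    tr-neg = +-inverseʳ-unique _ _ (trans (sym (tr-+ k w (- w))) (trans (tr-cong k (-‿inverseʳ w)) (tr-0# k)))

  tr-pow-q : ∀ k z → pow (tr k z) q ≈ tr k (pow z q)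
  tr-pow-q zero    z = InFq-0#
  tr-pow-q (suc k) z = trans (frobenius-q _ _) (+-congˡ (tr-pow-q k (pow z q)))

  tr-InFq : ∀ z → InFq (tr (suc d) z)
  tr-InFq z = trans (tr-pow-q (suc d) z) (+-cancelʳ z _ _ (begin
    tr (suc d) (pow z q) + z              ≈⟨ +-comm _ _ ⟩
    tr (suc (suc d)) z                    ≈⟨ tr-suc (suc d) z ⟩
    tr (suc d) z + pow z (q ^ suc d)    ≈⟨ +-congˡ (pow-qⁿ z) ⟩
    tr (suc d) z + z                      ∎))
    where open import Algebra.Properties.Ring ring using (+-cancelʳ)

  tr-degree : ∀ b k {D} → q ^ k ≤ D → DegreeBelow D (λ x → tr k (b * x))
  tr-degree b zero    {D} _    = degreeBelow-0# D
  tr-degree b (suc k) {D} qᵏ⁺¹≤D = degreeBelow-cong (λ x → trans (+-congˡ (sym (pow-distrib-* b x (q ^ k)))) (sym (tr-suc k (b * x))))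
    (degreeBelow-+ (tr-degree b k (ℕP.≤-trans (ℕP.<⇒≤ qᵏ<qᵏ⁺¹) qᵏ⁺¹≤D))
                   (degreeBelow-monomial (pow b (q ^ k)) (ℕP.<-≤-trans qᵏ<qᵏ⁺¹ qᵏ⁺¹≤D)))
    where
    qᵏ<qᵏ⁺¹ : q ^ k < q ^ suc k
    qᵏ<qᵏ⁺¹ = ℕP.^-monoʳ-< q 1<q (ℕP.n<1+n k)

  T : Carrier → Carrier → Carrier
  T b x = tr (suc d) (b * x)

  T-InFq : ∀ b x → InFq (T b x)
  T-InFq b x = tr-InFq (b * x)

  T-cong : ∀ b {x y} → x ≈ y → T b x ≈ T b y
  T-cong b x≈y = tr-cong (suc d) (*-congˡ x≈y)

  T-+ : ∀ b x y → T b (x + y) ≈ T b x + T b y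
  T-+ b x y = trans (tr-cong (suc d) (distribˡ b x y)) (tr-+ (suc d) _ _)

  T-− : ∀ b x y → T b (x - y) ≈ T b x - T b y
  T-− b x y = trans (tr-cong (suc d) (x[y-z]≈xy-xz b x y)) (tr-− (suc d) _ _)

  T-scale : ∀ b {t} → InFq t → ∀ x → T b (t * x) ≈ t * T b x
  T-scale b t∈ x = trans (tr-cong (suc d) (x*yz≈y*xz b _ x)) (tr-scale (suc d) t∈ (b * x))

  T-−ˡ : ∀ b b′ x → T (b - b′) x ≈ T b x - T b′ x
  T-−ˡ b b′ x = trans (tr-cong (suc d) ([y-z]x≈yx-zx x b b′)) (tr-− (suc d) _ _)

  T-0# : ∀ b → T b 0# ≈ 0#
  T-0# b = trans (tr-cong (suc d) (zeroʳ b)) (tr-0# (suc d))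

  kernel-bound : ∀ {b} → b ≉ 0# → ∀ {rs} → Unique rs → All (λ r → T b r ≈ 0#) rs → length rs ≤ q ^ d
  kernel-bound {b} b≉0 u rs∈ker = roots-bound (tr-degree b d ℕP.≤-refl) (pow-≉0 (q ^ d) b≉0) u
    (All.map (λ {r} Tr≈0 → trans (+-congˡ (sym (pow-distrib-* b r (q ^ d)))) (trans (sym (tr-suc d (b * r))) Tr≈0)) rs∈ker)

module TraceMultinomial {c ℓ} (F : FiniteField c ℓ) (q d : ℕ) (q-pp : IsPrimePower q)
                        (#F≡ : length (FiniteField.elems F) ≡ q ^ suc d) where
  open FiniteField F
  open FiniteFieldNotions F q
  open FieldArithmetic F q
  open FiniteFieldOrder F q
  open Subfield F q d q-pp #F≡
  open import Relation.Binary.Reasoning.Setoid setoid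
  open import Data.Nat.Combinatorics using (_C_; k>n⇒nCk≡0)

  multinomialTerm : Carrier → ℕ → ∀ {k} → Vec ℕ k → Carrier
  multinomialTerm z m j = if does (sumV j ℕ.≟ m) then cast (multinomial j) * pow z (weight q j) else 0#

  multinomialTerm-∷ : ∀ z m i {k} (j : Vec ℕ k) →
                      multinomialTerm z m (i ∷ j) ≈ cast (m C i) * (pow z i * multinomialTerm (pow z q) (m ∸ i) j)
  multinomialTerm-∷ z m i j with i ℕ.+ sumV j ℕ.≟ m | sumV j ℕ.≟ m ∸ i
  ... | yes i+s≡m | _ = begin
    multinomialTerm z m (i ∷ j)
      ≈⟨ if-yes (i ℕ.+ sumV j ℕ.≟ m) i+s≡m ⟩
    cast (((i ℕ.+ sumV j) C i) ℕ.* multinomial j) * pow z (i ℕ.+ q ℕ.* weight q j)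
      ≈⟨ *-cong (trans (reflexive (≡.cong (λ t → cast ((t C i) ℕ.* multinomial j)) i+s≡m)) (cast-* (m C i) (multinomial j)))
                (trans (pow-+ z i (q ℕ.* weight q j)) (*-congˡ (pow-* z q (weight q j)))) ⟩
    (cast (m C i) * cast (multinomial j)) * (pow z i * pow (pow z q) (weight q j))
      ≈⟨ trans (*-assoc _ _ _) (*-congˡ (x*yz≈y*xz _ _ _)) ⟩
    cast (m C i) * (pow z i * (cast (multinomial j) * pow (pow z q) (weight q j)))
      ≈⟨ *-congˡ (*-congˡ (if-yes (sumV j ℕ.≟ m ∸ i) (≡.trans (≡.sym (ℕP.m+n∸m≡n i (sumV j))) (≡.cong (_∸ i) i+s≡m)))) ⟨
    cast (m C i) * (pow z i * multinomialTerm (pow z q) (m ∸ i) j)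
      ∎
  ... | no i+s≢m | yes s≡m-i = trans (if-no (i ℕ.+ sumV j ℕ.≟ m) i+s≢m)
    (sym (trans (*-congʳ (reflexive (≡.cong cast (k>n⇒nCk≡0 m<i)))) (zeroˡ _)))
    where
    m<i : m < i
    m<i = ℕP.≰⇒> λ i≤m → i+s≢m (≡.trans (≡.cong (i ℕ.+_) s≡m-i) (ℕP.m+[n∸m]≡n i≤m))
  ... | no i+s≢m | no s≢m-i = trans (if-no (i ℕ.+ sumV j ℕ.≟ m) i+s≢m)
    (sym (trans (*-congˡ (trans (*-congˡ (if-no (sumV j ℕ.≟ m ∸ i) s≢m-i)) (zeroʳ _))) (zeroʳ _)))

  -- The entries of tuples k range below q, which covers every exponent occurring since m < q.
  tr-pow : ∀ k z {m} → m < q → pow (tr k z) m ≈ ΣL (tuples k) (multinomialTerm z m)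
  tr-pow zero    z {zero}  _ = sym (trans (+-identityʳ _) (trans (*-identityʳ _) (+-identityʳ 1#)))
  tr-pow zero    z {suc m} _ = trans (zeroˡ _) (sym (+-identityˡ 0#))
  tr-pow (suc k) z {m} m<q = sym (begin
    ΣL (tuples (suc k)) (multinomialTerm z m)
      ≈⟨ ΣL-concatMap (λ i → map (i ∷_) (tuples k)) (upTo q) (multinomialTerm z m) ⟩
    ΣL (upTo q) (λ i → ΣL (map (i ∷_) (tuples k)) (multinomialTerm z m))
      ≈⟨ ΣL-cong (upTo q) (λ i → reflexive (ΣL-map (i ∷_) (tuples k) (multinomialTerm z m))) ⟩
    ΣL (upTo q) (λ i → ΣL (tuples k) (λ j → multinomialTerm z m (i ∷ j)))
      ≈⟨ ΣL-cong (upTo q) (λ i → trans (ΣL-cong (tuples k) (multinomialTerm-∷ z m i)) (factor i)) ⟩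
    ΣL (upTo q) (λ i → cast (m C i) * (pow z i * ΣL (tuples k) (multinomialTerm (pow z q) (m ∸ i))))
      ≈⟨ ΣL-cong (upTo q) (λ i → *-congˡ (*-congˡ (sym (tr-pow k (pow z q) (ℕP.≤-<-trans (ℕP.m∸n≤m m i) m<q))))) ⟩
    ΣL (upTo q) binomialTerm
      ≈⟨ ΣL-upTo-vanishing (suc m) q binomialTerm m<q (λ i m<i → trans (*-congʳ (reflexive (≡.cong cast (k>n⇒nCk≡0 m<i)))) (zeroˡ _)) ⟩
    ΣL (upTo (suc m)) binomialTerm
      ≈⟨ binomial m z (tr k (pow z q)) ⟨
    pow (tr (suc k) z) m
      ∎)
    where
    binomialTerm : ℕ → Carrier
    binomialTerm i = cast (m C i) * (pow z i * pow (tr k (pow z q)) (m ∸ i))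
    factor : ∀ i → ΣL (tuples k) (λ j → cast (m C i) * (pow z i * multinomialTerm (pow z q) (m ∸ i) j))
                   ≈ cast (m C i) * (pow z i * ΣL (tuples k) (multinomialTerm (pow z q) (m ∸ i)))
    factor i = trans (sym (ΣL-distribˡ (tuples k) _ _)) (*-congˡ (sym (ΣL-distribˡ (tuples k) _ _)))

module FibreSum {c ℓ} (F : FiniteField c ℓ) (q d : ℕ) (q-pp : IsPrimePower q)
                (#F≡ : length (FiniteField.elems F) ≡ q ^ suc d) (1≤d : 1 ≤ d)
                (a : ℕ → FiniteField.Carrier F) where
  open FiniteField F
  open FiniteFieldNotions F q
  open FieldArithmetic F q
  open FiniteFieldOrder F q
  open Subfield F q d q-pp #F≡
  open TraceMultinomial F q d q-pp #F≡
  open import Relation.Binary.Reasoning.Setoid setoid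
  open import Function using (id)

  private
    n = suc d
    N = q ^ n
    f = polyFun N a

  Σf*pow : ∀ {J} → J < N ∸ 1 → ΣL elems (λ x → f x * pow x J) ≈ - a (N ∸ 1 ∸ J)
  Σf*pow = ≡.subst (λ M → ∀ {J} → J < M ∸ 1 → ΣL elems (λ x → polyFun M a x * pow x J) ≈ - a (M ∸ 1 ∸ J))
             #F≡ (ΣL-polyFun*pow a)

  Σf*multinomialTerm : ∀ b {m} → m < q → (j : Vec ℕ n) →
                       ΣL elems (λ x → f x * multinomialTerm (b * x) m j) ≈ - [ sumV j ≡ m ] term n a b j
  Σf*multinomialTerm b {m} m<q j with sumV j ℕ.≟ m
  ... | no |j|≢m = begin
    ΣL elems (λ x → f x * multinomialTerm (b * x) m j)   ≈⟨ ΣL-cong elems (λ x → trans (*-congˡ (if-no (sumV j ℕ.≟ m) |j|≢m)) (zeroʳ _)) ⟩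
    ΣL elems (λ _ → 0#)                                  ≈⟨ ΣL-0# elems ⟩
    0#                                                   ≈⟨ -0#≈0# ⟨
    - 0#                                                 ≈⟨ -‿cong (if-no (sumV j ℕ.≟ m) |j|≢m) ⟨
    - [ sumV j ≡ m ] term n a b j                        ∎
  ... | yes |j|≡m = begin
    ΣL elems (λ x → f x * multinomialTerm (b * x) m j)   ≈⟨ ΣL-cong elems (λ x → *-congˡ (if-yes (sumV j ℕ.≟ m) |j|≡m)) ⟩
    ΣL elems (λ x → f x * (K * pow (b * x) w))
      ≈⟨ ΣL-cong elems (λ x → trans (*-congˡ (*-congˡ (pow-distrib-* b x w))) (rearrange _ _ _ _)) ⟩
    ΣL elems (λ x → (K * pow b w) * (f x * pow x w))     ≈⟨ ΣL-distribˡ elems _ _ ⟨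
    (K * pow b w) * ΣL elems (λ x → f x * pow x w)       ≈⟨ *-congˡ (Σf*pow w<N∸1) ⟩
    (K * pow b w) * - a (N ∸ 1 ∸ w)                      ≈⟨ -‿distribʳ-* _ _ ⟨
    - ((K * pow b w) * a (N ∸ 1 ∸ w))                    ≈⟨ -‿cong (trans (*-assoc _ _ _) (trans (*-congˡ (*-comm _ _)) (sym (*-assoc _ _ _)))) ⟩
    - term n a b j                                       ≈⟨ -‿cong (if-yes (sumV j ℕ.≟ m) |j|≡m) ⟨
    - [ sumV j ≡ m ] term n a b j                        ∎
    where
    K = cast (multinomial j)
    w = weight q j
    w<N∸1 = weight<q^∸1 1<q 1≤d j (ℕP.<⇒≤pred (ℕP.≤-<-trans (ℕP.≤-reflexive |j|≡m) m<q))
    rearrange : ∀ u K B X → u * (K * (B * X)) ≈ (K * B) * (u * X)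
    rearrange u K B X = trans (x*yz≈y*xz u K _) (trans (*-congˡ (x*yz≈y*xz u B X)) (sym (*-assoc K B _)))

  Σf*T^ : ∀ b {m} → m < q → ΣL elems (λ x → f x * pow (T b x) m) ≈ - ΣL (tuples n) (λ j → [ sumV j ≡ m ] term n a b j)
  Σf*T^ b {m} m<q = begin
    ΣL elems (λ x → f x * pow (T b x) m)
      ≈⟨ ΣL-cong elems (λ x → trans (*-congˡ (tr-pow n (b * x) m<q)) (ΣL-distribˡ (tuples n) _ _)) ⟩
    ΣL elems (λ x → ΣL (tuples n) (λ j → f x * multinomialTerm (b * x) m j)) ≈⟨ ΣL-comm elems (tuples n) _ ⟩
    ΣL (tuples n) (λ j → ΣL elems (λ x → f x * multinomialTerm (b * x) m j)) ≈⟨ ΣL-cong (tuples n) (Σf*multinomialTerm b m<q) ⟩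
    ΣL (tuples n) (λ j → - [ sumV j ≡ m ] term n a b j)                ≈⟨ ΣL-neg (tuples n) _ ⟨
    - ΣL (tuples n) (λ j → [ sumV j ≡ m ] term n a b j)                ∎

  geometric-sum : Carrier → Carrier → ℕ → Carrier
  geometric-sum t u k = ΣL (upTo k) (λ i → pow t i * pow u (k ∸ 1 ∸ i))

  telescope : ∀ t u k → (t - u) * geometric-sum t u k ≈ pow t k - pow u k
  telescope t u zero    = trans (zeroʳ _) (sym (-‿inverseʳ 1#))
  telescope t u (suc k) = begin
    (t - u) * geometric-sum t u (suc k)                             ≈⟨ *-congˡ (ΣL-upTo-suc k _) ⟩
    (t - u) * (ΣL (upTo k) (λ i → pow t i * pow u (k ∸ i)) + pow t k * pow u (k ∸ k))
      ≈⟨ *-congˡ (+-cong shift (trans (*-congˡ (reflexive (≡.cong (pow u) (ℕP.n∸n≡0 k)))) (*-identityʳ _))) ⟩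
    (t - u) * (u * G + pow t k)                                     ≈⟨ distribˡ _ _ _ ⟩
    (t - u) * (u * G) + (t - u) * pow t k                           ≈⟨ +-congʳ (x*yz≈y*xz _ u G) ⟩
    u * ((t - u) * G) + (t - u) * pow t k                           ≈⟨ +-congʳ (*-congˡ (telescope t u k)) ⟩
    u * (pow t k - pow u k) + (t - u) * pow t k                     ≈⟨ +-cong (x[y-z]≈xy-xz u _ _) ([y-z]x≈yx-zx _ t u) ⟩
    (u * pow t k - pow u (suc k)) + (pow t (suc k) - u * pow t k)   ≈⟨ cancel _ _ _ ⟩
    pow t (suc k) - pow u (suc k)                                   ∎
    where
    G = geometric-sum t u k
    k∸i≡ : ∀ k {i} → i < k → k ∸ i ≡ suc (k ∸ 1 ∸ i)
    k∸i≡ (suc k) (s≤s i≤k) = ℕP.+-∸-assoc 1 i≤k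
    shift : ΣL (upTo k) (λ i → pow t i * pow u (k ∸ i)) ≈ u * G
    shift = trans (ΣL-cong-All (Allₚ.applyUpTo⁺₁ id k λ {i} i<k →
                     trans (*-congˡ (reflexive (≡.cong (pow u) (k∸i≡ k i<k)))) (x*yz≈y*xz _ u _)))
                  (sym (ΣL-distribˡ (upTo k) u _))
    cancel : ∀ A B C → (A - B) + (C - A) ≈ C - B
    cancel A B C = begin
      (A - B) + (C - A)     ≈⟨ +-comm _ _ ⟩
      (C - A) + (A - B)     ≈⟨ +-assoc C (- A) _ ⟩
      C + (- A + (A - B))   ≈⟨ +-congˡ (+-assoc (- A) A (- B)) ⟨
      C + ((- A + A) - B)   ≈⟨ +-congˡ (trans (+-congʳ (-‿inverseˡ A)) (+-identityˡ _)) ⟩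
      C - B                 ∎

  pow-q-1-geometric : ∀ {t u} → InFq t → InFq u → pow (t - u) (q ∸ 1) ≈ geometric-sum t u q
  pow-q-1-geometric {t} {u} t∈ u∈ with t ≟ u
  ... | yes t≈u = begin
    pow (t - u) (q ∸ 1)                        ≈⟨ pow-cong (q ∸ 1) (x≈y⇒x∙y⁻¹≈ε t≈u) ⟩
    pow 0# (q ∸ 1)                             ≈⟨ pow-0# (q ∸ 1) (ℕP.m<n⇒0<n∸m 1<q) ⟩
    0#                                         ≈⟨ trans (*-congʳ cast-q≈0) (zeroˡ _) ⟨
    cast q * pow u (q ∸ 1)                     ≡⟨ ≡.cong (λ k → cast k * pow u (q ∸ 1)) (length-upTo q) ⟨
    cast (length (upTo q)) * pow u (q ∸ 1)     ≈⟨ ΣL-const (upTo q) _ ⟨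
    ΣL (upTo q) (λ _ → pow u (q ∸ 1))          ≈⟨ ΣL-cong-All (Allₚ.applyUpTo⁺₁ id q split) ⟩
    geometric-sum t u q                        ∎
    where
    open import Data.List.Properties using (length-upTo)
    split : ∀ {i} → i < q → pow u (q ∸ 1) ≈ pow t i * pow u (q ∸ 1 ∸ i)
    split {i} i<q = begin
      pow u (q ∸ 1)                  ≡⟨ ≡.cong (pow u) (ℕP.m+[n∸m]≡n (ℕP.<⇒≤pred i<q)) ⟨
      pow u (i ℕ.+ (q ∸ 1 ∸ i))      ≈⟨ pow-+ u i _ ⟩
      pow u i * pow u (q ∸ 1 ∸ i)    ≈⟨ *-congʳ (pow-cong i t≈u) ⟨
      pow t i * pow u (q ∸ 1 ∸ i)    ∎
  ... | no t≉u = trans (InFq-pow-q-1 (InFq-− t∈ u∈) t-u≉0) (*-cancelˡ-≉0 t-u≉0 (begin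
    (t - u) * 1#                     ≈⟨ *-identityʳ _ ⟩
    t - u                            ≈⟨ +-cong t∈ (-‿cong u∈) ⟨
    pow t q - pow u q                ≈⟨ telescope t u q ⟨
    (t - u) * geometric-sum t u q    ∎))
    where
    t-u≉0 : t - u ≉ 0#
    t-u≉0 t-u≈0 = t≉u (x∙y⁻¹≈ε⇒x≈y t u t-u≈0)

  indicator-Fq : ∀ {t u} → InFq t → InFq u → (if does (t ≟ u) then 1# else 0#) ≈ 1# - pow (t - u) (q ∸ 1)
  indicator-Fq {t} {u} t∈ u∈ with t ≟ u
  ... | yes t≈u = sym (trans (+-congˡ (-‿cong (trans (pow-cong (q ∸ 1) (x≈y⇒x∙y⁻¹≈ε t≈u)) (pow-0# (q ∸ 1) (ℕP.m<n⇒0<n∸m 1<q)))))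
                         (trans (+-congˡ -0#≈0#) (+-identityʳ 1#)))
  ... | no  t≉u = sym (trans (+-congˡ (-‿cong (InFq-pow-q-1 (InFq-− t∈ u∈) λ t-u≈0 → t≉u (x∙y⁻¹≈ε⇒x≈y t u t-u≈0))))
                             (-‿inverseʳ 1#))

  coefficientSum : Carrier → Carrier → Carrier
  coefficientSum b u = ΣL (tuples n) (λ j → if does (sumV j ℕ.≤? q ∸ 1) then term n a b j * pow u (q ∸ 1 ∸ sumV j) else 0#)

  Σf*[T-u]^q-1 : ∀ b {u} → InFq u → ΣL elems (λ x → f x * pow (T b x - u) (q ∸ 1)) ≈ - coefficientSum b u
  Σf*[T-u]^q-1 b {u} u∈ = begin
    ΣL elems (λ x → f x * pow (T b x - u) (q ∸ 1))
      ≈⟨ ΣL-cong elems (λ x → trans (*-congˡ (pow-q-1-geometric (T-InFq b x) u∈)) (trans (ΣL-distribˡ (upTo q) _ _)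
                               (ΣL-cong (upTo q) (λ m → x*yz≈z*xy _ _ _)))) ⟩
    ΣL elems (λ x → ΣL (upTo q) (λ m → uᵐ m * (f x * pow (T b x) m)))
      ≈⟨ ΣL-comm elems (upTo q) _ ⟩
    ΣL (upTo q) (λ m → ΣL elems (λ x → uᵐ m * (f x * pow (T b x) m)))
      ≈⟨ ΣL-cong-All (Allₚ.applyUpTo⁺₁ id q λ {m} m<q →
           trans (sym (ΣL-distribˡ elems (uᵐ m) _)) (trans (*-congˡ (Σf*T^ b m<q)) (sym (-‿distribʳ-* _ _)))) ⟩
    ΣL (upTo q) (λ m → - (uᵐ m * ΣL (tuples n) (λ j → [ sumV j ≡ m ] term n a b j)))
      ≈⟨ ΣL-neg (upTo q) _ ⟨
    - ΣL (upTo q) (λ m → uᵐ m * ΣL (tuples n) (λ j → [ sumV j ≡ m ] term n a b j))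
      ≈⟨ -‿cong (ΣL-cong (upTo q) (λ m → ΣL-distribˡ (tuples n) (uᵐ m) _)) ⟩
    - ΣL (upTo q) (λ m → ΣL (tuples n) (λ j → uᵐ m * [ sumV j ≡ m ] term n a b j))
      ≈⟨ -‿cong (ΣL-comm (upTo q) (tuples n) _) ⟩
    - ΣL (tuples n) (λ j → ΣL (upTo q) (λ m → uᵐ m * [ sumV j ≡ m ] term n a b j))
      ≈⟨ -‿cong (ΣL-cong (tuples n) λ j → trans (ΣL-cong (upTo q) (λ m → flip (sumV j) m)) (collapse (sumV j))) ⟩
    - coefficientSum b u
      ∎
    where
    uᵐ : ℕ → Carrier
    uᵐ m = pow u (q ∸ 1 ∸ m)
    flip : ∀ s m {h} → uᵐ m * [ s ≡ m ] h ≈ [ m ≡ s ] (h * uᵐ m)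
    flip s m with s ℕ.≟ m
    ... | yes ≡.refl = trans (*-congˡ (if-yes (s ℕ.≟ s) ≡.refl)) (trans (*-comm _ _) (sym (if-yes (s ℕ.≟ s) ≡.refl)))
    ... | no  s≢m    = trans (*-congˡ (if-no (s ℕ.≟ m) s≢m)) (trans (zeroʳ _) (sym (if-no (m ℕ.≟ s) (s≢m ∘ ≡.sym))))
    collapse : ∀ s {h : ℕ → Carrier} → ΣL (upTo q) (λ m → [ m ≡ s ] h m) ≈ (if does (s ℕ.≤? q ∸ 1) then h s else 0#)
    collapse s {h} with s ℕ.≤? q ∸ 1
    ... | yes s≤q-1 = trans (ΣL-upTo-indicator h (ℕP.≤-trans (s≤s s≤q-1) (ℕP.≤-reflexive q-1+1≡q)))
                        (sym (if-yes (s ℕ.≤? q ∸ 1) s≤q-1))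
    ... | no  s≰q-1 = trans (ΣL-cong-All (Allₚ.applyUpTo⁺₁ id q λ {m} m<q →
                        if-no (m ℕ.≟ s) λ { ≡.refl → s≰q-1 (ℕP.<⇒≤pred m<q) }))
                        (trans (ΣL-0# (upTo q)) (sym (if-no (s ℕ.≤? q ∸ 1) s≰q-1)))

  Σf : ΣL elems f ≈ - a (N ∸ 1)
  Σf = trans (ΣL-cong elems (λ x → sym (*-identityʳ (f x)))) (Σf*pow (≡.subst (λ M → 0 < M ∸ 1) #F≡ #F∸1>0))

  fibre-sum : ∀ b {u} → InFq u →
              ΣL elems (λ x → f x * (if does (T b x ≟ u) then 1# else 0#)) ≈ - a (N ∸ 1) + coefficientSum b u
  fibre-sum b {u} u∈ = begin
    ΣL elems (λ x → f x * (if does (T b x ≟ u) then 1# else 0#))  ≈⟨ ΣL-cong elems (λ x → *-congˡ (indicator-Fq (T-InFq b x) u∈)) ⟩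
    ΣL elems (λ x → f x * (1# - P x))
      ≈⟨ ΣL-cong elems (λ x → trans (x[y-z]≈xy-xz _ _ _) (+-congʳ (*-identityʳ _))) ⟩
    ΣL elems (λ x → f x - f x * P x)                              ≈⟨ ΣL-+ elems _ _ ⟩
    ΣL elems f + ΣL elems (λ x → - (f x * P x))                   ≈⟨ +-cong (sym Σf) (ΣL-neg elems _) ⟨
    - a (N ∸ 1) + - ΣL elems (λ x → f x * P x)                    ≈⟨ +-congˡ (-‿cong (Σf*[T-u]^q-1 b u∈)) ⟩
    - a (N ∸ 1) + - - coefficientSum b u                          ≈⟨ +-congˡ (-‿involutive _) ⟩
    - a (N ∸ 1) + coefficientSum b u                              ∎
    where
    P : Carrier → Carrier
    P x = pow (T b x - u) (q ∸ 1)

  fibre-sum-≈0 : ∀ b {u} → u ≈ 0# → ΣL elems (λ x → f x * (if does (T b x ≟ u) then 1# else 0#))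
                                     ≈ - a (N ∸ 1) + ΣL (filter (λ j → sumV j ℕ.≟ (q ∸ 1)) (tuples n)) (term n a b)
  fibre-sum-≈0 b {u} u≈0 = trans (fibre-sum b (InFq-resp (sym u≈0) InFq-0#))
    (+-congˡ (trans (ΣL-cong (tuples n) only-top) (sym (ΣL-filter (λ j → sumV j ℕ.≟ (q ∸ 1)) (tuples n) (term n a b)))))
    where
    only-top : (j : Vec ℕ n) → (if does (sumV j ℕ.≤? q ∸ 1) then term n a b j * pow u (q ∸ 1 ∸ sumV j) else 0#)
                               ≈ (if does (sumV j ℕ.≟ q ∸ 1) then term n a b j else 0#)
    only-top j with sumV j ℕ.≟ q ∸ 1 | sumV j ℕ.≤? q ∸ 1
    ... | yes |j|≡q-1 | _ = begin
      _                                       ≈⟨ if-yes (sumV j ℕ.≤? q ∸ 1) (ℕP.≤-reflexive |j|≡q-1) ⟩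
      term n a b j * pow u (q ∸ 1 ∸ sumV j)   ≡⟨ ≡.cong (λ s → term n a b j * pow u (q ∸ 1 ∸ s)) |j|≡q-1 ⟩
      term n a b j * pow u (q ∸ 1 ∸ (q ∸ 1))  ≡⟨ ≡.cong (λ k → term n a b j * pow u k) (ℕP.n∸n≡0 (q ∸ 1)) ⟩
      term n a b j * 1#                       ≈⟨ *-identityʳ _ ⟩
      term n a b j                            ≈⟨ if-yes (sumV j ℕ.≟ q ∸ 1) |j|≡q-1 ⟨
      _                                       ∎
    ... | no |j|≢q-1 | yes |j|≤q-1 = trans (if-yes (sumV j ℕ.≤? q ∸ 1) |j|≤q-1)
      (trans (*-congˡ (trans (pow-cong (q ∸ 1 ∸ sumV j) u≈0) (pow-0# _ (ℕP.m<n⇒0<n∸m (ℕP.≤∧≢⇒< |j|≤q-1 |j|≢q-1)))))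
             (trans (zeroʳ _) (sym (if-no (sumV j ℕ.≟ q ∸ 1) |j|≢q-1))))
    ... | no |j|≢q-1 | no |j|≰q-1 = trans (if-no (sumV j ℕ.≤? q ∸ 1) |j|≰q-1) (sym (if-no (sumV j ℕ.≟ q ∸ 1) |j|≢q-1))

  Σ[|j|≡0]term : ∀ b → ΣL (tuples n) (λ j → [ sumV j ≡ 0 ] term n a b j) ≈ a (N ∸ 1)
  Σ[|j|≡0]term b = -‿injective (trans (sym (Σf*T^ b (ℕP.<-trans (s≤s z≤n) 1<q))) (trans (ΣL-cong elems (λ x → *-identityʳ (f x))) Σf))
    where open import Algebra.Properties.Ring ring using (-‿injective)

  fibre-sum-≉0 : ∀ b {u} → InFq u → u ≉ 0# →
                 ΣL elems (λ x → f x * (if does (T b x ≟ u) then 1# else 0#))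
                   ≈ ΣL (filter (λ j → (1 ℕ.≤? sumV j) ×-dec (sumV j ℕ.≤? (q ∸ 1))) (tuples n))
                        (λ j → term n a b j * pow u ((q ∸ 1) ∸ sumV j))
  fibre-sum-≉0 b {u} u∈ u≉0 = begin
    ΣL elems (λ x → f x * (if does (T b x ≟ u) then 1# else 0#))
      ≈⟨ fibre-sum b u∈ ⟩
    - a (N ∸ 1) + coefficientSum b u
      ≈⟨ +-congˡ (trans (ΣL-cong (tuples n) split) (ΣL-+ (tuples n) _ _)) ⟩
    - a (N ∸ 1) + (ΣL (tuples n) (λ j → [ sumV j ≡ 0 ] term n a b j) + ΣL (tuples n) (λ j → if does (P? j) then X j else 0#))
      ≈⟨ +-congˡ (+-cong (Σ[|j|≡0]term b) (sym (ΣL-filter P? (tuples n) X))) ⟩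
    - a (N ∸ 1) + (a (N ∸ 1) + ΣL (filter P? (tuples n)) X)
      ≈⟨ trans (sym (+-assoc _ _ _)) (trans (+-congʳ (-‿inverseˡ _)) (+-identityˡ _)) ⟩
    ΣL (filter P? (tuples n)) X
      ∎
    where
    P? : (j : Vec ℕ n) → Dec ((1 ≤ sumV j) × (sumV j ≤ q ∸ 1))
    P? j = (1 ℕ.≤? sumV j) ×-dec (sumV j ℕ.≤? (q ∸ 1))
    X : Vec ℕ n → Carrier
    X j = term n a b j * pow u ((q ∸ 1) ∸ sumV j)
    split : (j : Vec ℕ n) → (if does (sumV j ℕ.≤? q ∸ 1) then X j else 0#)
                            ≈ [ sumV j ≡ 0 ] term n a b j + (if does (P? j) then X j else 0#)
    split j with sumV j ℕ.≟ 0 | sumV j ℕ.≤? q ∸ 1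
    ... | yes |j|≡0 | _ = begin
      _                                          ≈⟨ if-yes (sumV j ℕ.≤? q ∸ 1) (≡.subst (_≤ q ∸ 1) (≡.sym |j|≡0) z≤n) ⟩
      term n a b j * pow u (q ∸ 1 ∸ sumV j)      ≡⟨ ≡.cong (λ s → term n a b j * pow u (q ∸ 1 ∸ s)) |j|≡0 ⟩
      term n a b j * pow u (q ∸ 1)               ≈⟨ trans (*-congˡ (InFq-pow-q-1 u∈ u≉0)) (*-identityʳ _) ⟩
      term n a b j                               ≈⟨ +-identityʳ _ ⟨
      term n a b j + 0#
        ≈⟨ +-cong (if-yes (sumV j ℕ.≟ 0) |j|≡0) (if-no (P? j) λ (1≤|j| , _) → ℕP.<⇒≢ 1≤|j| (≡.sym |j|≡0)) ⟨
      _                                          ∎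
    ... | no |j|≢0 | yes |j|≤q-1 = sym (trans (+-cong (if-no (sumV j ℕ.≟ 0) |j|≢0) (if-yes (P? j) (ℕP.n≢0⇒n>0 |j|≢0 , |j|≤q-1)))
                                              (trans (+-identityˡ _) (sym (if-yes (sumV j ℕ.≤? q ∸ 1) |j|≤q-1))))
    ... | no |j|≢0 | no |j|≰q-1  = sym (trans (+-cong (if-no (sumV j ℕ.≟ 0) |j|≢0) (if-no (P? j) (|j|≰q-1 ∘ proj₂)))
                                              (trans (+-identityˡ _) (sym (if-no (sumV j ℕ.≤? q ∸ 1) |j|≰q-1))))

module Hyperplanes {c ℓ} (F : FiniteField c ℓ) (q d : ℕ) (q-pp : IsPrimePower q)
                   (#F≡ : length (FiniteField.elems F) ≡ q ^ suc d) where
  open FiniteField F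
  open FiniteFieldNotions F q
  open FieldArithmetic F q
  open Subfield F q d q-pp #F≡
  open import Relation.Binary.Reasoning.Setoid setoid
  open import Data.List.Membership.Setoid setoid using (_∈_)
  open import Data.List.Relation.Unary.Unique.Setoid setoid using (Unique)
  open import Data.Vec.Relation.Binary.Pointwise.Inductive using (Pointwise; []; _∷_)
  open import Data.Vec.Relation.Binary.Equality.Setoid setoid using (≋-setoid)
  import Data.List.Relation.Unary.Unique.Setoid.Properties as Uniqueₚ
  import Data.List.Relation.Unary.Any.Properties as Anyₚ

  private variable
    k : ℕ

  InFqᵛ : Vec Carrier k → Set (c ⊔ ℓ)
  InFqᵛ = VAll.All InFq

  Span : Vec Carrier k → Carrier → Set (c ⊔ ℓ)
  Span {k} v x = ∃ λ (cs : Vec Carrier k) → InFqᵛ cs × x ≈ lin cs v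

  affine : Carrier → Vec Carrier k → List Carrier
  affine {k} a v = map (λ cs → a + lin cs v) (allVecs Fq k)

  affineSum≡ : ∀ g a (v : Vec Carrier k) → affineSum g a v ≡ ΣL (affine a v) g
  affineSum≡ {k} g a v = ≡.sym (ΣL-map (λ cs → a + lin cs v) (allVecs Fq k) g)

  length-affine : ∀ a (v : Vec Carrier k) → length (affine a v) ≡ length Fq ^ k
  length-affine {k} a v = ≡.trans (Data.List.Properties.length-map _ (allVecs Fq k)) (length-allVecs Fq k)
    where import Data.List.Properties

  lin-cong : ∀ {cs ds : Vec Carrier k} (v : Vec Carrier k) → Pointwise _≈_ cs ds → lin cs v ≈ lin ds v
  lin-cong []      []          = refl
  lin-cong (_ ∷ v) (c≈d ∷ cs≈ds) = +-cong (*-congʳ c≈d) (lin-cong v cs≈ds)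

  lin-− : ∀ (cs ds v : Vec Carrier k) → lin cs v - lin ds v ≈ lin (Vec.zipWith _-_ cs ds) v
  lin-− []       []       []      = -‿inverseʳ 0#
  lin-− (c ∷ cs) (d ∷ ds) (x ∷ v) = begin
    (c * x + lin cs v) - (d * x + lin ds v)      ≈⟨ +-congˡ (sym (-‿+-comm _ _)) ⟩
    (c * x + lin cs v) + (- (d * x) - lin ds v)  ≈⟨ +-interchange _ _ _ _ ⟩
    (c * x - d * x) + (lin cs v - lin ds v)      ≈⟨ +-cong ([y-z]x≈yx-zx x c d) (sym (lin-− cs ds v)) ⟨
    (c - d) * x + lin (Vec.zipWith _-_ cs ds) v  ∎

  lin-scale : ∀ t (cs v : Vec Carrier k) → lin (Vec.map (t *_) cs) v ≈ t * lin cs v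
  lin-scale t []       []      = sym (zeroʳ t)
  lin-scale t (c ∷ cs) (x ∷ v) = trans (+-cong (*-assoc t c x) (lin-scale t cs v)) (sym (distribˡ t _ _))

  InFqᵛ-− : ∀ {cs ds : Vec Carrier k} → InFqᵛ cs → InFqᵛ ds → InFqᵛ (Vec.zipWith _-_ cs ds)
  InFqᵛ-− VAll.[]            VAll.[]            = VAll.[]
  InFqᵛ-− (c∈ VAll.∷ cs∈) (d∈ VAll.∷ ds∈) = InFq-− c∈ d∈ VAll.∷ InFqᵛ-− cs∈ ds∈

  InFqᵛ-scale : ∀ {t} {cs : Vec Carrier k} → InFq t → InFqᵛ cs → InFqᵛ (Vec.map (t *_) cs)
  InFqᵛ-scale t∈ VAll.[]          = VAll.[]
  InFqᵛ-scale t∈ (c∈ VAll.∷ cs∈) = InFq-* t∈ c∈ VAll.∷ InFqᵛ-scale t∈ cs∈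

  ∈-affine⁺ : ∀ a (v : Vec Carrier k) {x} (cs : Vec Carrier k) → InFqᵛ cs → x ≈ a + lin cs v → x ∈ affine a v
  ∈-affine⁺ a v cs cs∈ x≈ = Anyₚ.map⁺ (Any.map (λ cs≋ → trans x≈ (+-congˡ (lin-cong v cs≋)))
                                         (∈-allVecs setoid (VAll.map ∈-Fq cs∈)))

  ∈-affine⁻ : ∀ a (v : Vec Carrier k) {x} → x ∈ affine a v → ∃ λ (cs : Vec Carrier k) → InFqᵛ cs × x ≈ a + lin cs v
  ∈-affine⁻ {k} a v x∈ = All.lookupWith (λ {cs} cs∈ x≈ → cs , cs∈ , x≈) (allVecs-All k Fq-InFq) (Anyₚ.map⁻ x∈)

  affine-unique : ∀ a {v : Vec Carrier k} → IndependentFq v → Unique (affine a v)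
  affine-unique {k} a {v} independent = AllPairsₚ.map⁺
    (AllPairs-map-All injective (allVecs-All k Fq-InFq) (allVecs-unique setoid k Fq-unique))
    where
    import Data.List.Relation.Unary.AllPairs.Properties as AllPairsₚ
    open import Algebra.Properties.Ring ring using (+-cancelˡ)
    ≈0⇒≋ : ∀ {k} (cs ds : Vec Carrier k) → VAll.All (_≈ 0#) (Vec.zipWith _-_ cs ds) → Pointwise _≈_ cs ds
    ≈0⇒≋ []       []       VAll.[]             = []
    ≈0⇒≋ (c ∷ cs) (d ∷ ds) (c-d≈0 VAll.∷ ≈0s) = x∙y⁻¹≈ε⇒x≈y c d c-d≈0 ∷ ≈0⇒≋ cs ds ≈0s
    injective : ∀ {cs ds} → InFqᵛ cs → InFqᵛ ds → ¬ Pointwise _≈_ cs ds → ¬ a + lin cs v ≈ a + lin ds v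
    injective {cs} {ds} cs∈ ds∈ cs≉ds a+cs≈a+ds = cs≉ds (≈0⇒≋ cs ds (independent _ (InFqᵛ-− cs∈ ds∈)
      (trans (sym (lin-− cs ds v)) (x≈y⇒x∙y⁻¹≈ε (+-cancelˡ a _ _ a+cs≈a+ds)))))

  span? : ∀ (v : Vec Carrier k) x → Dec (Span v x)
  span? v x with Any.any? (x ≟_) (affine 0# v)
  ... | yes x∈ = let cs , cs∈ , x≈ = ∈-affine⁻ 0# v x∈ in yes (cs , cs∈ , trans x≈ (+-identityˡ _))
  ... | no  x∉ = no λ (cs , cs∈ , x≈) → x∉ (∈-affine⁺ 0# v cs cs∈ (trans x≈ (sym (+-identityˡ _))))

  independent-[] : IndependentFq []
  independent-[] [] _ _ = VAll.[]

  independent-∷ : ∀ {v : Vec Carrier k} {w} → IndependentFq v → ¬ Span v w → IndependentFq (w ∷ v)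
  independent-∷ {v = v} {w} independent w∉ (c ∷ cs) (c∈ VAll.∷ cs∈) cw+cs≈0 with c ≟ 0#
  ... | yes c≈0 = c≈0 VAll.∷ independent cs cs∈ (begin
    lin cs v              ≈⟨ +-identityˡ _ ⟨
    0# + lin cs v         ≈⟨ +-congʳ (trans (*-congʳ c≈0) (zeroˡ w)) ⟨
    c * w + lin cs v      ≈⟨ cw+cs≈0 ⟩
    0#                    ∎)
  ... | no  c≉0 with inverse c c≉0
  ...   | c⁻¹ , cc⁻¹≈1 = ⊥-elim (w∉ (Vec.map (- c⁻¹ *_) cs , InFqᵛ-scale (InFq-neg (InFq-inverse c∈ cc⁻¹≈1)) cs∈ , sym (begin
    lin (Vec.map (- c⁻¹ *_) cs) v    ≈⟨ lin-scale (- c⁻¹) cs v ⟩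
    - c⁻¹ * lin cs v                 ≈⟨ trans (sym (-‿distribˡ-* c⁻¹ _)) (-‿distribʳ-* c⁻¹ _) ⟩
    c⁻¹ * - lin cs v                 ≈⟨ *-congˡ (+-inverseʳ-unique _ _ (trans (+-comm _ _) cw+cs≈0)) ⟨
    c⁻¹ * (c * w)                    ≈⟨ *-assoc c⁻¹ c w ⟨
    (c⁻¹ * c) * w                    ≈⟨ *-congʳ (trans (*-comm c⁻¹ c) cc⁻¹≈1) ⟩
    1# * w                           ≈⟨ *-identityˡ w ⟩
    w                                ∎)))

  InKernel : Carrier → Vec Carrier k → Set (c ⊔ ℓ)
  InKernel b = VAll.All (λ x → T b x ≈ 0#)

  SpansKernel : Carrier → Vec Carrier k → Set (c ⊔ ℓ)
  SpansKernel b v = ∀ x → T b x ≈ 0# → Span v x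

  T-lin : ∀ b {cs v : Vec Carrier k} → InFqᵛ cs → InKernel b v → T b (lin cs v) ≈ 0#
  T-lin b {[]}     {[]}    VAll.[]          VAll.[]              = T-0# b
  T-lin b {c ∷ cs} {x ∷ v} (c∈ VAll.∷ cs∈) (Tx≈0 VAll.∷ Tv≈0) = begin
    T b (c * x + lin cs v)          ≈⟨ T-+ b _ _ ⟩
    T b (c * x) + T b (lin cs v)    ≈⟨ +-cong (trans (T-scale b c∈ x) (trans (*-congˡ Tx≈0) (zeroʳ c))) (T-lin b cs∈ Tv≈0) ⟩
    0# + 0#                         ≈⟨ +-identityˡ 0# ⟩
    0#                              ∎

  affine⊆kernel : ∀ b (v : Vec Carrier k) → InKernel b v → All (λ x → T b x ≈ 0#) (affine 0# v)
  affine⊆kernel {k} b v Tv≈0 = Allₚ.map⁺ (All.map (λ cs∈ → trans (T-cong b (+-identityˡ _)) (T-lin b cs∈ Tv≈0)) (allVecs-All k Fq-InFq))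

  independent-bound : ∀ {v : Vec Carrier k} → IndependentFq v → length Fq ^ k ≤ length elems
  independent-bound {v = v} independent = ≡.subst (_≤ length elems) (length-affine 0# v)
    (UniqueLists.length-mono-⊆ setoid (affine-unique 0# independent) (λ {x} _ → complete x))

  kernel-independent-bound : ∀ {b} → b ≉ 0# → ∀ {v : Vec Carrier k} → IndependentFq v → InKernel b v →
                             length Fq ^ k ≤ q ^ d
  kernel-independent-bound b≉0 {v} independent Tv≈0 = ≡.subst (_≤ q ^ d) (length-affine 0# v)
    (kernel-bound b≉0 (affine-unique 0# independent) (affine⊆kernel _ v Tv≈0))

  ∃-nonkernel : ∀ {b} → b ≉ 0# → ∃ λ w → T b w ≉ 0#
  ∃-nonkernel {b} b≉0 with All.all? (λ x → T b x ≟ 0#) elems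
  ... | yes all≈0 = ⊥-elim (ℕP.<⇒≱ qᵈ<qᵈ⁺¹ (≡.subst (_≤ q ^ d) #F≡ (kernel-bound b≉0 distinct all≈0)))
    where qᵈ<qᵈ⁺¹ = ℕP.^-monoʳ-< q 1<q (ℕP.n<1+n d)
  ... | no ¬all≈0 = Any.satisfied (Allₚ.¬All⇒Any¬ (λ x → T b x ≟ 0#) elems ¬all≈0)

  T-surjective : ∀ {b} → b ≉ 0# → ∀ {u} → InFq u → ∃ λ x → T b x ≈ u
  T-surjective {b} b≉0 {u} u∈ with ∃-nonkernel b≉0
  ... | w , Tw≉0 with inverse (T b w) Tw≉0
  ...   | Tw⁻¹ , TwTw⁻¹≈1 = (u * Tw⁻¹) * w , (begin
    T b ((u * Tw⁻¹) * w)     ≈⟨ T-scale b (InFq-* u∈ (InFq-inverse (T-InFq b w) TwTw⁻¹≈1)) w ⟩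
    (u * Tw⁻¹) * T b w       ≈⟨ trans (*-assoc _ _ _) (*-congˡ (*-comm _ _)) ⟩
    u * (T b w * Tw⁻¹)       ≈⟨ trans (*-congˡ TwTw⁻¹≈1) (*-identityʳ u) ⟩
    u                        ∎)

  spans-or-extends : ∀ b (v : Vec Carrier k) → SpansKernel b v ⊎ ∃ λ x → T b x ≈ 0# × ¬ Span v x
  spans-or-extends b v with All.all? (λ x → (T b x ≟ 0#) →-dec (span? v x)) elems
  ... | yes all = inj₁ λ x Tx≈0 → All.lookupWith (λ {y} spans-y x≈y → span-resp x≈y (spans-y (trans (T-cong b (sym x≈y)) Tx≈0)))
                                                 all (complete x)
    where
    span-resp : ∀ {x y} → x ≈ y → Span v y → Span v x
    span-resp x≈y (cs , cs∈ , y≈) = cs , cs∈ , trans x≈y y≈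
  ... | no ¬all with Any.satisfied (Allₚ.¬All⇒Any¬ (λ x → (T b x ≟ 0#) →-dec (span? v x)) elems ¬all)
  ...   | x , ¬[Tx≈0→span] with T b x ≟ 0#
  ...     | yes Tx≈0 = inj₂ (x , Tx≈0 , λ x∈span → ¬[Tx≈0→span] (λ _ → x∈span))
  ...     | no  Tx≉0 = ⊥-elim (¬[Tx≈0→span] (λ Tx≈0 → ⊥-elim (Tx≉0 Tx≈0)))

  kernel-family : ∀ b r → ∃₂ λ k (v : Vec Carrier k) → IndependentFq v × InKernel b v × (SpansKernel b v ⊎ r ≤ k)
  kernel-family b zero    = 0 , [] , independent-[] , VAll.[] , inj₂ z≤n
  kernel-family b (suc r) with kernel-family b r
  ... | k , v , independent , Tv≈0 , inj₁ spans = k , v , independent , Tv≈0 , inj₁ spans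
  ... | k , v , independent , Tv≈0 , inj₂ r≤k with spans-or-extends b v
  ...   | inj₁ spans              = k , v , independent , Tv≈0 , inj₁ spans
  ...   | inj₂ (x , Tx≈0 , x∉) = suc k , x ∷ v , independent-∷ independent x∉ , Tx≈0 VAll.∷ Tv≈0 , inj₂ (s≤s r≤k)

  2≤length-Fq : 2 ≤ length Fq
  2≤length-Fq = UniqueLists.length-mono-⊆ setoid ((0≉1 ∷ []) ∷ [] ∷ [])
    λ { (here x≈0) → ∈-resp-≈ setoid (sym x≈0) (∈-Fq InFq-0#)
      ; (there (here x≈1)) → ∈-resp-≈ setoid (sym x≈1) (∈-Fq InFq-1#) }
    where open import Data.List.Membership.Setoid.Properties using (∈-resp-≈)

  kernel-spanning-family : ∀ b → ∃₂ λ k (v : Vec Carrier k) → IndependentFq v × InKernel b v × SpansKernel b v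
  kernel-spanning-family b with kernel-family b (suc (length elems))
  ... | k , v , independent , Tv≈0 , inj₁ spans = k , v , independent , Tv≈0 , spans
  ... | k , v , independent , Tv≈0 , inj₂ #F<k  = ⊥-elim (ℕP.<-irrefl ≡.refl
    (ℕP.<-trans (n<2^n k) (ℕP.≤-<-trans (ℕP.^-monoˡ-≤ k 2≤length-Fq) (ℕP.≤-<-trans (independent-bound independent) #F<k))))

  spanning-bound : ∀ {b} → b ≉ 0# → ∀ {v : Vec Carrier k} → SpansKernel b v → q ^ suc d ≤ length Fq ^ suc k
  spanning-bound {b = b} b≉0 {v} spans with ∃-nonkernel b≉0
  ... | w , Tw≉0 with inverse (T b w) Tw≉0
  ...   | Tw⁻¹ , TwTw⁻¹≈1 = ≡.subst₂ _≤_ #F≡ (length-affine 0# (w ∷ v))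
    (UniqueLists.length-mono-⊆ setoid distinct (λ {x} _ → ∈-span x))
    where
    coefficient : Carrier → Carrier
    coefficient x = T b x * Tw⁻¹
    coefficient∈ : ∀ x → InFq (coefficient x)
    coefficient∈ x = InFq-* (T-InFq b x) (InFq-inverse (T-InFq b w) TwTw⁻¹≈1)
    ∈-span : ∀ x → x ∈ affine 0# (w ∷ v)
    ∈-span x with spans (x - coefficient x * w) (begin
      T b (x - coefficient x * w)          ≈⟨ T-− b x _ ⟩
      T b x - T b (coefficient x * w)      ≈⟨ +-congˡ (-‿cong (T-scale b (coefficient∈ x) w)) ⟩
      T b x - coefficient x * T b w
        ≈⟨ +-congˡ (-‿cong (trans (*-assoc _ _ _) (trans (*-congˡ (trans (*-comm _ _) TwTw⁻¹≈1)) (*-identityʳ _)))) ⟩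
      T b x - T b x                        ≈⟨ -‿inverseʳ _ ⟩
      0#                                   ∎)
    ... | cs , cs∈ , x-tw≈ = ∈-affine⁺ 0# (w ∷ v) (coefficient x ∷ cs) (coefficient∈ x VAll.∷ cs∈) (begin
      x                                    ≈⟨ x-y+y≈x x (coefficient x * w) ⟨
      (x - coefficient x * w) + coefficient x * w  ≈⟨ +-congʳ x-tw≈ ⟩
      lin cs v + coefficient x * w         ≈⟨ +-comm _ _ ⟩
      lin (coefficient x ∷ cs) (w ∷ v)     ≈⟨ +-identityˡ _ ⟨
      0# + lin (coefficient x ∷ cs) (w ∷ v) ∎)

  length-Fq≡q : length Fq ≡ q
  length-Fq≡q with kernel-spanning-family 1#
  ... | k , v , independent , Tv≈0 , spans = ℕP.≤-antisym length-Fq≤q (ℕP.*-cancelʳ-≤ q (length Fq) (q ^ d)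
    (ℕP.≤-trans (spanning-bound 1≉0 spans) (ℕP.*-monoʳ-≤ (length Fq) (kernel-independent-bound 1≉0 independent Tv≈0))))
    where
    instance _ = ℕ.>-nonZero (ℕP.m^n>0 q {{ℕ.>-nonZero (ℕP.<-trans (s≤s z≤n) 1<q)}} d)

  IsKernelBasis : Carrier → Vec Carrier k → Set (c ⊔ ℓ)
  IsKernelBasis b v = IndependentFq v × InKernel b v × SpansKernel b v

  kernel-basis : ∀ {b} → b ≉ 0# → Σ (Vec Carrier d) (IsKernelBasis b)
  kernel-basis {b} b≉0 with kernel-spanning-family b
  ... | k , v , basis@(independent , Tv≈0 , spans) = ≡.subst (λ k → Σ (Vec Carrier k) (IsKernelBasis b)) k≡d (v , basis)
    where
    qᵏ≤qᵈ : q ^ k ≤ q ^ d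
    qᵏ≤qᵈ = ≡.subst (λ s → s ^ k ≤ q ^ d) length-Fq≡q (kernel-independent-bound b≉0 independent Tv≈0)
    qᵈ⁺¹≤qᵏ⁺¹ : q ^ suc d ≤ q ^ suc k
    qᵈ⁺¹≤qᵏ⁺¹ = ≡.subst (λ s → q ^ suc d ≤ s ^ suc k) length-Fq≡q (spanning-bound b≉0 spans)
    k≡d : k ≡ d
    k≡d = ℕP.≤-antisym (ℕP.≮⇒≥ λ d<k → ℕP.<⇒≱ (ℕP.^-monoʳ-< q 1<q d<k) qᵏ≤qᵈ)
                       (ℕP.≮⇒≥ λ k<d → ℕP.<⇒≱ (ℕP.^-monoʳ-< q 1<q (s≤s k<d)) qᵈ⁺¹≤qᵏ⁺¹)

  independent-spans-kernel : ∀ {b} → b ≉ 0# → ∀ {v : Vec Carrier d} → IndependentFq v → InKernel b v → SpansKernel b v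
  independent-spans-kernel b≉0 {v} independent Tv≈0 x Tx≈0 with span? v x
  ... | yes x∈span = x∈span
  ... | no  x∉span = ⊥-elim (ℕP.<⇒≱ (ℕP.^-monoʳ-< q 1<q (ℕP.n<1+n d))
    (≡.subst (λ s → s ^ suc d ≤ q ^ d) length-Fq≡q
      (kernel-independent-bound b≉0 (independent-∷ independent x∉span) (Tx≈0 VAll.∷ Tv≈0))))

  -- x ↦ (T x v₁, …, T x v_d) cannot be injective, as F has more elements than F_q^d.
  annihilator : (v : Vec Carrier d) → ¬ ¬ (∃ λ b → b ≉ 0# × InKernel b v)
  annihilator v ∄b = ℕP.<⇒≱ (ℕP.^-monoʳ-< q 1<q (ℕP.n<1+n d))
    (≡.subst₂ _≤_ (≡.trans (length-map ψ elems) #F≡) (≡.trans (length-allVecs Fq d) (≡.cong (_^ d) length-Fq≡q))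
      (UniqueLists.length-mono-⊆ (≋-setoid d) (Uniqueₚ.map⁺ setoid (≋-setoid d) ψ-injective distinct) ψ⊆))
    where
    open import Data.List.Properties using (length-map)
    open import Data.List.Membership.Setoid.Properties using (∈-map⁻; ∈-resp-≈)
    open Setoid (≋-setoid d) using () renaming (sym to ≋-sym)
    open import Data.List.Membership.Setoid (≋-setoid d) using () renaming (_∈_ to _∈ᵛ_)
    ψ : Carrier → Vec Carrier d
    ψ x = Vec.map (T x) v
    ψ∈ : ∀ x {k} (w : Vec Carrier k) → VAll.All (_∈ Fq) (Vec.map (T x) w)
    ψ∈ x []      = VAll.[]
    ψ∈ x (y ∷ w) = ∈-Fq (T-InFq x y) VAll.∷ ψ∈ x w
    ψ⊆ : ∀ {w} → w ∈ᵛ map ψ elems → w ∈ᵛ allVecs Fq d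
    ψ⊆ w∈ with ∈-map⁻ setoid (≋-setoid d) w∈
    ... | x , _ , w≋ψx = ∈-resp-≈ (≋-setoid d) (≋-sym w≋ψx) (∈-allVecs setoid (ψ∈ x v))
    ψ-injective : ∀ {x y} → Pointwise _≈_ (ψ x) (ψ y) → x ≈ y
    ψ-injective {x} {y} ψx≋ψy with x ≟ y
    ... | yes x≈y = x≈y
    ... | no  x≉y = ⊥-elim (∄b (x - y , (λ x-y≈0 → x≉y (x∙y⁻¹≈ε⇒x≈y x y x-y≈0)) , annihilates v ψx≋ψy))
      where
      annihilates : ∀ {k} (w : Vec Carrier k) → Pointwise _≈_ (Vec.map (T x) w) (Vec.map (T y) w) → InKernel (x - y) w
      annihilates []      []              = VAll.[]
      annihilates (z ∷ w) (Txz≈Tyz ∷ eqs) = trans (T-−ˡ x y z) (x≈y⇒x∙y⁻¹≈ε Txz≈Tyz) VAll.∷ annihilates w eqs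

  affineSum≈fibreSum : ∀ {b} {v : Vec Carrier k} → IsKernelBasis b v → ∀ a₀ {u} → T b a₀ ≈ u →
                       ∀ g → (∀ {x y} → x ≈ y → g x ≈ g y) →
                       affineSum g a₀ v ≈ ΣL elems (λ x → g x * (if does (T b x ≟ u) then 1# else 0#))
  affineSum≈fibreSum {b = b} {v} (independent , Tv≈0 , spans) a₀ {u} Ta₀≈u g g-cong = begin
    affineSum g a₀ v                                   ≡⟨ affineSum≡ g a₀ v ⟩
    ΣL (affine a₀ v) g                                 ≈⟨ ΣL-reindex setoid g g-cong (affine-unique a₀ independent)
                                                            (Uniqueₚ.filter⁺ setoid P? distinct) affine⊆fibre fibre⊆affine ⟩
    ΣL (filter P? elems) g                             ≈⟨ ΣL-filter P? elems g ⟩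
    ΣL elems (λ x → if does (P? x) then g x else 0#)   ≈⟨ ΣL-cong elems indicator ⟩
    ΣL elems (λ x → g x * (if does (P? x) then 1# else 0#)) ∎
    where
    open import Data.List.Membership.Setoid.Properties using (∈-filter⁺; ∈-filter⁻)
    P? = λ x → T b x ≟ u
    P-resp : ∀ {x y} → x ≈ y → T b x ≈ u → T b y ≈ u
    P-resp x≈y Tx≈u = trans (T-cong b (sym x≈y)) Tx≈u
    affine⊆fibre : ∀ {x} → x ∈ affine a₀ v → x ∈ filter P? elems
    affine⊆fibre {x} x∈ with ∈-affine⁻ a₀ v x∈
    ... | cs , cs∈ , x≈ = ∈-filter⁺ setoid P? P-resp (complete x) (begin
      T b x                         ≈⟨ T-cong b x≈ ⟩
      T b (a₀ + lin cs v)           ≈⟨ T-+ b a₀ _ ⟩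
      T b a₀ + T b (lin cs v)       ≈⟨ +-cong Ta₀≈u (T-lin b cs∈ Tv≈0) ⟩
      u + 0#                        ≈⟨ +-identityʳ u ⟩
      u                             ∎)
    fibre⊆affine : ∀ {x} → x ∈ filter P? elems → x ∈ affine a₀ v
    fibre⊆affine {x} x∈
      with spans (x - a₀) (trans (T-− b x a₀) (x≈y⇒x∙y⁻¹≈ε (trans (proj₂ (∈-filter⁻ setoid P? P-resp {xs = elems} x∈)) (sym Ta₀≈u))))
    ... | cs , cs∈ , x-a₀≈ = ∈-affine⁺ a₀ v cs cs∈ (trans (sym (x-y+y≈x x a₀)) (trans (+-comm _ _) (+-congˡ x-a₀≈)))
    indicator : ∀ x → (if does (P? x) then g x else 0#) ≈ g x * (if does (P? x) then 1# else 0#)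
    indicator x with P? x
    ... | yes _ = sym (*-identityʳ _)
    ... | no  _ = sym (zeroʳ _)

module SumFreeCharacterisation {c ℓ} (F : FiniteField c ℓ) (q d : ℕ) (q-pp : IsPrimePower q)
                               (#F≡ : length (FiniteField.elems F) ≡ q ^ suc d) (1≤d : 1 ≤ d)
                               (a : ℕ → FiniteField.Carrier F) where
  open FiniteField F
  open FiniteFieldNotions F q
  open FieldArithmetic F q
  open Subfield F q d q-pp #F≡
  open FibreSum F q d q-pp #F≡ 1≤d a
  open Hyperplanes F q d q-pp #F≡

  private
    f = polyFun (q ^ suc d) a

  f-cong : ∀ {x y} → x ≈ y → f x ≈ f y
  f-cong x≈y = ΣL-cong (upTo (q ^ suc d)) (λ i → *-congˡ (pow-cong i x≈y))

  FibreSumsNonzero : Set (c ⊔ ℓ)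
  FibreSumsNonzero = ∀ {b} → b ≉ 0# → ∀ {u} → InFq u → ¬ ΣL elems (λ x → f x * (if does (T b x ≟ u) then 1# else 0#)) ≈ 0#

  sum-free⇒fibre-sums-nonzero : SumFree d f → FibreSumsNonzero
  sum-free⇒fibre-sums-nonzero sum-free b≉0 u∈ Σ≈0 =
    let v , basis = kernel-basis b≉0
        a₀ , Ta₀≈u = T-surjective b≉0 u∈
    in sum-free a₀ v (proj₁ basis) (trans (affineSum≈fibreSum basis a₀ Ta₀≈u f f-cong) Σ≈0)

  fibre-sums-nonzero⇒sum-free : FibreSumsNonzero → SumFree d f
  fibre-sums-nonzero⇒sum-free fibre-sums≉0 a₀ v independent affineSum≈0 = annihilator v λ (b , b≉0 , Tv≈0) →
    let basis = independent , Tv≈0 , independent-spans-kernel b≉0 independent Tv≈0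
    in fibre-sums≉0 b≉0 (T-InFq b a₀) (trans (sym (affineSum≈fibreSum basis a₀ refl f f-cong)) affineSum≈0)

  fibre-sums-nonzero⇒conditions : FibreSumsNonzero → Condition1 (suc d) a × Condition2 (suc d) a
  fibre-sums-nonzero⇒conditions fibre-sums≉0 =
    (λ b b≉0 a≈Σ → fibre-sums≉0 b≉0 InFq-0# (trans (fibre-sum-≈0 b refl) (trans (+-congˡ (sym a≈Σ)) (-‿inverseˡ _)))) ,
    (λ b b≉0 u u∈ u≉0 Σ≈0 → fibre-sums≉0 b≉0 u∈ (trans (fibre-sum-≉0 b u∈ u≉0) Σ≈0))

  conditions⇒fibre-sums-nonzero : Condition1 (suc d) a × Condition2 (suc d) a → FibreSumsNonzero
  conditions⇒fibre-sums-nonzero (condition1 , condition2) {b} b≉0 {u} u∈ Σ≈0 with u ≟ 0#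
  ... | yes u≈0 = condition1 b b≉0 (trans (sym (-‿involutive _)) (sym (+-inverseʳ-unique _ _ (trans (sym (fibre-sum-≈0 b u≈0)) Σ≈0))))
  ... | no  u≉0 = condition2 b b≉0 u u∈ u≉0 (trans (sym (fibre-sum-≉0 b u∈ u≉0)) Σ≈0)

proposition4p2 : ∀ {c ℓ : Level} (q n : ℕ) (F : FiniteField c ℓ) →
    IsPrimePower q → 2 ≤ n → length (FiniteField.elems F) ≡ q ^ n →
    (a : ℕ → FiniteField.Carrier F) →
    FiniteFieldNotions.SumFree F q (n ∸ 1) (FiniteFieldNotions.polyFun F q (q ^ n) a)
    ⇔ (FiniteFieldNotions.Condition1 F q n a × FiniteFieldNotions.Condition2 F q n a)
proposition4p2 q (suc d) F q-pp (s≤s 1≤d) #F≡ a =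
  mk⇔ (fibre-sums-nonzero⇒conditions ∘ sum-free⇒fibre-sums-nonzero)
      (fibre-sums-nonzero⇒sum-free ∘ conditions⇒fibre-sums-nonzero)
  where open SumFreeCharacterisation F q d q-pp #F≡ 1≤d a
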